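{- Let $\mathcal G$ be the set of all $\Gamma$-free $0$-$1$ matrices of all sizes $n\times k$ with $n,k\ge 0$. For $m\in\mathcal G$ let $r(m)$ be its number of rows, $c(m)$ its number of columns, $r_e(m)$ its number of all-zero rows, $c_e(m)$ its number of all-zero columns, and $r_t(m)$ its number of top rows. Then, as formal power series, \[\sum_{m\in\mathcal G}t^{r_t(m)}a^{r_e(m)}b^{c_e(m)}\frac{x^{r(m)}}{r(m)!}\frac{y^{c(m)}}{c(m)!}=\frac{e^{ax}e^{by}}{1-t(e^x-1)(e^y-1)}.\]
   Context: A $0$-$1$ matrix is $\Gamma$-free if there are no two $1$'s in the same row together with a third $1$ strictly below the left one of these two in the same column (i.e. no $2\times2$ submatrix, rows and columns in original order, of the form $\begin{pmatrix}1&1\\1&*\end{pmatrix}$). For each $n,k\ge0$, the matrices of size $n\times 0$ and $0\times k$ (one of each size) are included in $\mathcal G$. A $1$ of a matrix is a top-$1$ if it is the highest $1$ in its column (no $1$ above it in the same column); a top row is a row containing at least one top-$1$. -}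

module Defs where

open import Data.Bool using (Bool; true; false; _∧_; _∨_; not; if_then_else_)
open import Data.Nat as ℕ using (ℕ; zero; suc; _∸_; _!; _≡ᵇ_; _<ᵇ_)
open import Data.Nat.Properties using (_!≢0)
open import Data.Fin as Fin using (Fin; toℕ)
open import Data.List as List using (List; []; _∷_; map; concatMap; filter; length; allFin; upTo; foldr)
open import Data.Bool.ListAction using (all; any)
open import Data.Vec as Vec using (Vec; []; _∷_; lookup)
open import Data.Integer using (+_)
open import Data.Rational as ℚ using (ℚ; 0ℚ; 1ℚ; _+_; _*_; _-_)

Matrix : ℕ → ℕ → Set
Matrix n k = Vec (Vec Bool k) n

entry : ∀ {n k} → Matrix n k → Fin n → Fin k → Bool
entry m i j = lookup (lookup m i) j

allVecs : (k : ℕ) → List (Vec Bool k)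
allVecs zero    = [] ∷ []
allVecs (suc k) = concatMap (λ v → (false ∷ v) ∷ (true ∷ v) ∷ []) (allVecs k)

allMatrices : (n k : ℕ) → List (Matrix n k)
allMatrices zero    k = [] ∷ []
allMatrices (suc n) k =
  concatMap (λ r → map (λ m → r ∷ m) (allMatrices n k)) (allVecs k)

_<F_ : ∀ {n} → Fin n → Fin n → Bool
i <F i' = toℕ i <ᵇ toℕ i'

Γ-free : ∀ {n k} → Matrix n k → Bool
Γ-free {n} {k} m =
  all (λ i → all (λ i' → all (λ j → all (λ j' →
      not ((i <F i') ∧ (j <F j') ∧ entry m i j ∧ entry m i j' ∧ entry m i' j))
    (allFin k)) (allFin k)) (allFin n)) (allFin n)

rₑ : ∀ {n k} → Matrix n k → ℕ
rₑ {n} {k} m = length (filter (λ i → all (λ j → not (entry m i j)) (allFin k) Data.Bool.≟ true) (allFin n))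
  where import Data.Bool

cₑ : ∀ {n k} → Matrix n k → ℕ
cₑ {n} {k} m = length (filter (λ j → all (λ i → not (entry m i j)) (allFin n) Data.Bool.≟ true) (allFin k))
  where import Data.Bool

isTop1 : ∀ {n k} → Matrix n k → Fin n → Fin k → Bool
isTop1 {n} m i j = entry m i j ∧ all (λ i' → not ((i' <F i) ∧ entry m i' j)) (allFin n)

rₜ : ∀ {n k} → Matrix n k → ℕ
rₜ {n} {k} m = length (filter (λ i → any (λ j → isTop1 m i j) (allFin k) Data.Bool.≟ true) (allFin n))
  where import Data.Bool

-- Formal power series in the variables t, a, b, x, y with rational
-- coefficients: coeff i j l p q is the coefficient of t^i a^j b^l x^p y^q.

PS : Set
PS = ℕ → ℕ → ℕ → ℕ → ℕ → ℚ

Σ≤ : ℕ → (ℕ → ℚ) → ℚ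
Σ≤ N f = foldr (λ s acc → f s + acc) 0ℚ (upTo (suc N))

ps0 : PS
ps0 _ _ _ _ _ = 0ℚ

ps1 : PS
ps1 zero zero zero zero zero = 1ℚ
ps1 _ _ _ _ _ = 0ℚ

_⊕_ : PS → PS → PS
(f ⊕ g) i j l p q = f i j l p q + g i j l p q

_⊖_ : PS → PS → PS
(f ⊖ g) i j l p q = f i j l p q - g i j l p q

_⊛_ : PS → PS → PS
(f ⊛ g) i j l p q =
  Σ≤ i λ i₁ → Σ≤ j λ j₁ → Σ≤ l λ l₁ → Σ≤ p λ p₁ → Σ≤ q λ q₁ →
    f i₁ j₁ l₁ p₁ q₁ * g (i ∸ i₁) (j ∸ j₁) (l ∸ l₁) (p ∸ p₁) (q ∸ q₁)

_^ps_ : PS → ℕ → PS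
f ^ps zero  = ps1
f ^ps suc s = f ⊛ (f ^ps s)

-- 1 / (1 - F) for F with zero constant term: the geometric series Σ_s F^s.
-- Coefficientwise this is a finite sum, since F^s has no monomials of
-- total degree < s; so summing s up to the total degree is exact.
geom : PS → PS
geom F i j l p q = Σ≤ (i ℕ.+ j ℕ.+ l ℕ.+ p ℕ.+ q) (λ s → (F ^ps s) i j l p q)

-- multiplicative inverse of a series D with constant term 1:  1/D = 1/(1 - (1 - D))
inv : PS → PS
inv D = geom (ps1 ⊖ D)

inv! : ℕ → ℚ
inv! n = ℚ._/_ (+ 1) (n !) {{n !≢0}}

var-t : PS
var-t (suc zero) zero zero zero zero = 1ℚ
var-t _ _ _ _ _ = 0ℚ

exp-x : PS
exp-x zero zero zero p zero = inv! p
exp-x _ _ _ _ _ = 0ℚ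

exp-y : PS
exp-y zero zero zero zero q = inv! q
exp-y _ _ _ _ _ = 0ℚ

exp-ax : PS
exp-ax zero j zero p zero = if j ≡ᵇ p then inv! p else 0ℚ
exp-ax _ _ _ _ _ = 0ℚ

exp-by : PS
exp-by zero zero l zero q = if l ≡ᵇ q then inv! q else 0ℚ
exp-by _ _ _ _ _ = 0ℚ

countG : (i j l n k : ℕ) → ℕ
countG i j l n k =
  length (filter (λ m → (Γ-free m ∧ (rₜ m ≡ᵇ i) ∧ (rₑ m ≡ᵇ j) ∧ (cₑ m ≡ᵇ l)) Data.Bool.≟ true)
                 (allMatrices n k))
  where import Data.Bool

LHS : PS
LHS i j l n k = (ℚ._/_ (+ countG i j l n k) 1) * inv! n * inv! k

RHS : PS
RHS = (exp-ax ⊛ exp-by) ⊛ inv (ps1 ⊖ (var-t ⊛ ((exp-x ⊖ ps1) ⊛ (exp-y ⊖ ps1))))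

-- Build the matrices row by row from the top.  Call a column blocked if it contains a 1 with another 1 to
-- its right in the same row, and free if it is nonzero and not blocked.  A new bottom row keeps the matrix
-- Γ-free iff its 1s avoid the blocked columns, and its effect on the statistics (top rows, zero rows, zero
-- columns, free columns) only depends on how many of its 1s lie on zero columns and on free columns.
-- Counting rows by these two numbers gives a recurrence, solved by C(n,j) S₂(n−j,s) · C(k,l) surj(k−l,s) · c₁(s,f)
-- for s top rows, j zero rows, l zero columns and f free columns.  Summing over f gives s!, and
-- S₂(n−j,s) s! = surj(n−j,s).  On the series side, the t^s term of the geometric series is
-- (e^x − 1)^s (e^y − 1)^s, with x^p y^q coefficient surj(p,s) surj(q,s) / (p! q!), and the factor e^{ax} e^{by}
-- inserts the j zero rows and l zero columns.

module Submission where

open import Defs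
open import Data.Nat using (ℕ)
open import Relation.Binary.PropositionalEquality using (_≡_; cong; sym; trans)

module Sums where

  open import Data.Nat
  open import Data.Nat.Properties
  open import Data.Nat.Tactic.RingSolver
  open import Data.Bool using (Bool; true; false; _∧_)
  open import Relation.Binary.PropositionalEquality
  open import Relation.Nullary using (yes; no)
  open ≡-Reasoning

  Σ< : ℕ → (ℕ → ℕ) → ℕ
  Σ< zero    f = 0
  Σ< (suc n) f = f 0 + Σ< n (λ i → f (suc i))

  Σ<-cong : ∀ n {f g : ℕ → ℕ} → (∀ i → i < n → f i ≡ g i) → Σ< n f ≡ Σ< n g
  Σ<-cong zero    h = refl
  Σ<-cong (suc n) h = cong₂ _+_ (h 0 z<s) (Σ<-cong n (λ i p → h (suc i) (s<s p)))

  Σ<-ext : ∀ n {f g : ℕ → ℕ} → (∀ i → f i ≡ g i) → Σ< n f ≡ Σ< n g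
  Σ<-ext n h = Σ<-cong n (λ i _ → h i)

  Σ<-zero : ∀ n {f : ℕ → ℕ} → (∀ i → i < n → f i ≡ 0) → Σ< n f ≡ 0
  Σ<-zero zero    h = refl
  Σ<-zero (suc n) h = cong₂ _+_ (h 0 z<s) (Σ<-zero n (λ i p → h (suc i) (s<s p)))

  Σ<-+ : ∀ n (f g : ℕ → ℕ) → Σ< n (λ i → f i + g i) ≡ Σ< n f + Σ< n g
  Σ<-+ zero    f g = refl
  Σ<-+ (suc n) f g rewrite Σ<-+ n (λ i → f (suc i)) (λ i → g (suc i)) =
    +-interchange (f 0) (g 0) (Σ< n (λ i → f (suc i))) (Σ< n (λ i → g (suc i)))
    where
      +-interchange : ∀ a b c d → a + b + (c + d) ≡ a + c + (b + d)
      +-interchange = solve-∀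

  Σ<-*ˡ : ∀ n c (f : ℕ → ℕ) → c * Σ< n f ≡ Σ< n (λ i → c * f i)
  Σ<-*ˡ zero    c f = *-zeroʳ c
  Σ<-*ˡ (suc n) c f = trans (*-distribˡ-+ c (f 0) _) (cong (c * f 0 +_) (Σ<-*ˡ n c _))

  Σ<-last : ∀ n (f : ℕ → ℕ) → Σ< (suc n) f ≡ Σ< n f + f n
  Σ<-last zero    f = +-comm (f 0) 0
  Σ<-last (suc n) f =
    trans (cong (f 0 +_) (Σ<-last n (λ i → f (suc i)))) (sym (+-assoc (f 0) _ _))

  Σ<-split : ∀ m n (f : ℕ → ℕ) → Σ< (m + n) f ≡ Σ< m f + Σ< n (λ i → f (m + i))
  Σ<-split zero    n f = refl
  Σ<-split (suc m) n f =
    trans (cong (f 0 +_) (Σ<-split m n (λ i → f (suc i)))) (sym (+-assoc (f 0) _ _))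

  Σ<-single : ∀ n e (f : ℕ → ℕ) → e < n → (∀ i → i ≢ e → f i ≡ 0) → Σ< n f ≡ f e
  Σ<-single (suc n) zero    f p h =
    trans (cong (f 0 +_) (Σ<-zero n (λ i _ → h (suc i) (λ ())))) (+-identityʳ _)
  Σ<-single (suc n) (suc e) f (s≤s p) h =
    trans (cong (_+ Σ< n (λ i → f (suc i))) (h 0 (λ ())))
          (Σ<-single n e (λ i → f (suc i)) p (λ i q → h (suc i) (λ r → q (suc-injective r))))

  Σ<-extend : ∀ m n (f : ℕ → ℕ) → m ≤ n → (∀ i → m ≤ i → f i ≡ 0) → Σ< n f ≡ Σ< m f
  Σ<-extend zero    n       f _       h = Σ<-zero n (λ i _ → h i z≤n)
  Σ<-extend (suc m) (suc n) f (s≤s p) h =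
    cong (f 0 +_) (Σ<-extend m n (λ i → f (suc i)) p (λ i q → h (suc i) (s≤s q)))

  b2n : Bool → ℕ
  b2n true  = 1
  b2n false = 0

  ≡ᵇ-refl : ∀ n → (n ≡ᵇ n) ≡ true
  ≡ᵇ-refl zero    = refl
  ≡ᵇ-refl (suc n) = ≡ᵇ-refl n

  ≢⇒≡ᵇ-false : ∀ {m n} → m ≢ n → (m ≡ᵇ n) ≡ false
  ≢⇒≡ᵇ-false {zero}  {zero}  m≢n with () ← m≢n refl
  ≢⇒≡ᵇ-false {zero}  {suc n} m≢n = refl
  ≢⇒≡ᵇ-false {suc m} {zero}  m≢n = refl
  ≢⇒≡ᵇ-false {suc m} {suc n} m≢n = ≢⇒≡ᵇ-false (λ m≡n → m≢n (cong suc m≡n))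

  +-cancelˡ-≡ᵇ : ∀ c x y → (c + x ≡ᵇ c + y) ≡ (x ≡ᵇ y)
  +-cancelˡ-≡ᵇ zero    x y = refl
  +-cancelˡ-≡ᵇ (suc c) x y = +-cancelˡ-≡ᵇ c x y

  +-cancelʳ-≡ᵇ : ∀ x y c → (x + c ≡ᵇ y + c) ≡ (x ≡ᵇ y)
  +-cancelʳ-≡ᵇ x y c rewrite +-comm x c | +-comm y c = +-cancelˡ-≡ᵇ c x y

  +≡ᵇ-split : ∀ x d y → (x + d ≡ᵇ y) ≡ (d ≤ᵇ y) ∧ (x ≡ᵇ y ∸ d)
  +≡ᵇ-split x zero    y       rewrite +-identityʳ x = refl
  +≡ᵇ-split x (suc d) zero    rewrite +-suc x d = refl
  +≡ᵇ-split x (suc zero)    (suc y) rewrite +-suc x 0       = +≡ᵇ-split x 0 y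
  +≡ᵇ-split x (suc (suc d)) (suc y) rewrite +-suc x (suc d) = +≡ᵇ-split x (suc d) y

  isZero : ℕ → ℕ
  isZero zero    = 1
  isZero (suc _) = 0

  isPos : ℕ → ℕ
  isPos zero    = 0
  isPos (suc _) = 1

  -- Defined by Pascal's rule (rather than via factorials, as Data.Nat.Combinatorics._C_) so that it computes.
  binom : ℕ → ℕ → ℕ
  binom n       zero    = 1
  binom zero    (suc k) = 0
  binom (suc n) (suc k) = binom n k + binom n (suc k)

  binom-above : ∀ n k → n < k → binom n k ≡ 0
  binom-above zero    (suc k) p = refl
  binom-above (suc n) (suc k) (s≤s p) =
    cong₂ _+_ (binom-above n k p) (binom-above n (suc k) (m≤n⇒m≤1+n p))

  binom-diag : ∀ n → binom n n ≡ 1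
  binom-diag zero    = refl
  binom-diag (suc n) = cong₂ _+_ (binom-diag n) (binom-above n (suc n) ≤-refl)

  Σ<-pascal : ∀ N Z (ψ : ℕ → ℕ) →
    Σ< (suc N) (λ a → binom (suc Z) a * ψ a) ≡
    Σ< (suc N) (λ a → binom Z a * ψ a) + Σ< N (λ a → binom Z a * ψ (suc a))
  Σ<-pascal N Z ψ = begin
    1 * ψ 0 + Σ< N (λ a → (binom Z a + binom Z (suc a)) * ψ (suc a))
      ≡⟨ cong (1 * ψ 0 +_) (trans (Σ<-ext N (λ a → *-distribʳ-+ (ψ (suc a)) (binom Z a) (binom Z (suc a))))
                                  (Σ<-+ N _ _)) ⟩
    1 * ψ 0 + (Σ< N (λ a → binom Z a * ψ (suc a)) + Σ< N (λ a → binom Z (suc a) * ψ (suc a)))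
      ≡⟨ rearrange (1 * ψ 0) _ _ ⟩
    (1 * ψ 0 + Σ< N (λ a → binom Z (suc a) * ψ (suc a))) + Σ< N (λ a → binom Z a * ψ (suc a)) ∎
    where
      rearrange : ∀ a b c → a + (b + c) ≡ (a + c) + b
      rearrange = solve-∀

  binom-factorials : ∀ a b → binom (a + b) a * (a ! * b !) ≡ (a + b) !
  binom-factorials zero    b = trans (*-identityˡ _) (*-identityˡ _)
  binom-factorials (suc a) zero = begin
    binom (suc a + 0) (suc a) * (suc a ! * 1) ≡⟨ cong (λ x → binom x (suc a) * (suc a ! * 1)) (+-identityʳ (suc a)) ⟩
    binom (suc a) (suc a) * (suc a ! * 1)     ≡⟨ cong (_* (suc a ! * 1)) (binom-diag (suc a)) ⟩
    1 * (suc a ! * 1)                         ≡⟨ trans (*-identityˡ _) (*-identityʳ _) ⟩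
    suc a !                                   ≡⟨ cong _! (sym (+-identityʳ (suc a))) ⟩
    (suc a + 0) ! ∎
  binom-factorials (suc a) (suc b) = begin
    (binom (a + suc b) a + binom (a + suc b) (suc a)) * (suc a ! * suc b !)
      ≡⟨ *-distribʳ-+ _ (binom (a + suc b) a) _ ⟩
    binom (a + suc b) a * (suc a ! * suc b !) + binom (a + suc b) (suc a) * (suc a ! * suc b !)
      ≡⟨ cong₂ _+_ left right ⟩
    suc a * (a + suc b) ! + suc b * (a + suc b) !
      ≡⟨ sym (*-distribʳ-+ ((a + suc b) !) (suc a) (suc b)) ⟩
    (suc a + suc b) * (a + suc b) ! ∎
    where
      left : binom (a + suc b) a * (suc a ! * suc b !) ≡ suc a * (a + suc b) !
      left = begin
        binom (a + suc b) a * ((suc a * a !) * suc b !)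
          ≡⟨ shuffle (binom (a + suc b) a) (suc a) (a !) (suc b !) ⟩
        suc a * (binom (a + suc b) a * (a ! * suc b !))
          ≡⟨ cong (suc a *_) (binom-factorials a (suc b)) ⟩
        suc a * (a + suc b) ! ∎
        where
          shuffle : ∀ x y z w → x * ((y * z) * w) ≡ y * (x * (z * w))
          shuffle = solve-∀
      right : binom (a + suc b) (suc a) * (suc a ! * suc b !) ≡ suc b * (a + suc b) !
      right = begin
        binom (a + suc b) (suc a) * (suc a ! * suc b !)
          ≡⟨ cong (λ x → binom x (suc a) * (suc a ! * suc b !)) (+-suc a b) ⟩
        binom (suc a + b) (suc a) * (suc a ! * (suc b * b !))
          ≡⟨ shuffle (binom (suc a + b) (suc a)) (suc a !) (suc b) (b !) ⟩
        suc b * (binom (suc a + b) (suc a) * (suc a ! * b !))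
          ≡⟨ cong (suc b *_) (binom-factorials (suc a) b) ⟩
        suc b * (suc a + b) !
          ≡⟨ cong (λ x → suc b * x !) (sym (+-suc a b)) ⟩
        suc b * (a + suc b) ! ∎
        where
          shuffle : ∀ x y z w → x * (y * (z * w)) ≡ z * (x * (y * w))
          shuffle = solve-∀

  binom-sym : ∀ a b → binom (a + b) a ≡ binom (a + b) b
  binom-sym a b = *-cancelʳ-≡ (binom (a + b) a) (binom (a + b) b) (a ! * b !) {{a !* b !≢0}} (begin
    binom (a + b) a * (a ! * b !) ≡⟨ binom-factorials a b ⟩
    (a + b) !                     ≡⟨ cong _! (+-comm a b) ⟩
    (b + a) !                     ≡⟨ sym (binom-factorials b a) ⟩
    binom (b + a) b * (b ! * a !) ≡⟨ cong₂ (λ x y → binom x b * y) (+-comm b a) (*-comm (b !) (a !)) ⟩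
    binom (a + b) b * (a ! * b !) ∎)

  binom-trinomial : ∀ l a r → binom (l + a) a * binom (l + a + r) (l + a) ≡ binom (l + a + r) l * binom (a + r) a
  binom-trinomial l a r = *-cancelʳ-≡ _ _ (l ! * a ! * r !) {{m*n≢0 (l ! * a !) (r !) {{l !* a !≢0}} {{r !≢0}}}} (begin
    binom (l + a) a * binom (l + a + r) (l + a) * (l ! * a ! * r !)
      ≡⟨ cong (λ z → z * binom (l + a + r) (l + a) * (l ! * a ! * r !)) (sym (binom-sym l a)) ⟩
    binom (l + a) l * binom (l + a + r) (l + a) * (l ! * a ! * r !)
      ≡⟨ shuffle₁ (binom (l + a) l) (binom (l + a + r) (l + a)) (l !) (a !) (r !) ⟩
    binom (l + a + r) (l + a) * ((binom (l + a) l * (l ! * a !)) * r !)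
      ≡⟨ cong (λ z → binom (l + a + r) (l + a) * (z * r !)) (binom-factorials l a) ⟩
    binom (l + a + r) (l + a) * ((l + a) ! * r !)
      ≡⟨ binom-factorials (l + a) r ⟩
    (l + a + r) !
      ≡⟨ cong _! (+-assoc l a r) ⟩
    (l + (a + r)) !
      ≡⟨ sym (binom-factorials l (a + r)) ⟩
    binom (l + (a + r)) l * (l ! * (a + r) !)
      ≡⟨ cong (λ z → binom (l + (a + r)) l * (l ! * z)) (sym (binom-factorials a r)) ⟩
    binom (l + (a + r)) l * (l ! * (binom (a + r) a * (a ! * r !)))
      ≡⟨ cong (λ z → binom z l * (l ! * (binom (a + r) a * (a ! * r !)))) (sym (+-assoc l a r)) ⟩
    binom (l + a + r) l * (l ! * (binom (a + r) a * (a ! * r !)))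
      ≡⟨ shuffle₂ (binom (l + a + r) l) (binom (a + r) a) (l !) (a !) (r !) ⟩
    binom (l + a + r) l * binom (a + r) a * (l ! * a ! * r !) ∎)
    where
      shuffle₁ : ∀ b c x y z → b * c * (x * y * z) ≡ c * ((b * (x * y)) * z)
      shuffle₁ = solve-∀
      shuffle₂ : ∀ b c x y z → b * (x * (c * (y * z))) ≡ b * c * (x * y * z)
      shuffle₂ = solve-∀

  binom-subset-of-subset : ∀ l a k → binom (l + a) a * binom k (l + a) ≡ binom k l * binom (k ∸ l) a
  binom-subset-of-subset l a k with (l + a) ≤? k
  ... | yes l+a≤k = begin
    binom (l + a) a * binom k (l + a)           ≡⟨ cong (λ z → binom (l + a) a * binom z (l + a)) (sym l+a+r≡k) ⟩
    binom (l + a) a * binom (l + a + r) (l + a) ≡⟨ binom-trinomial l a r ⟩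
    binom (l + a + r) l * binom (a + r) a       ≡⟨ cong₂ (λ x y → binom x l * binom y a) l+a+r≡k a+r≡k∸l ⟩
    binom k l * binom (k ∸ l) a ∎
    where
      r = k ∸ (l + a)
      l+a+r≡k : l + a + r ≡ k
      l+a+r≡k = m+[n∸m]≡n l+a≤k
      a+r≡k∸l : a + r ≡ k ∸ l
      a+r≡k∸l = begin
        a + r           ≡⟨ sym (m+n∸m≡n l (a + r)) ⟩
        l + (a + r) ∸ l ≡⟨ cong (_∸ l) (sym (+-assoc l a r)) ⟩
        l + a + r ∸ l   ≡⟨ cong (_∸ l) l+a+r≡k ⟩
        k ∸ l ∎
  ... | no l+a≰k with l ≤? k
  ...   | no l≰k = begin
    binom (l + a) a * binom k (l + a) ≡⟨ cong (binom (l + a) a *_) (binom-above k (l + a) (≰⇒> l+a≰k)) ⟩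
    binom (l + a) a * 0               ≡⟨ *-zeroʳ (binom (l + a) a) ⟩
    0                                 ≡⟨ sym (cong (_* binom (k ∸ l) a) (binom-above k l (≰⇒> l≰k))) ⟩
    binom k l * binom (k ∸ l) a ∎
  ...   | yes l≤k = begin
    binom (l + a) a * binom k (l + a) ≡⟨ cong (binom (l + a) a *_) (binom-above k (l + a) (≰⇒> l+a≰k)) ⟩
    binom (l + a) a * 0               ≡⟨ *-zeroʳ (binom (l + a) a) ⟩
    0                                 ≡⟨ sym (*-zeroʳ (binom k l)) ⟩
    binom k l * 0                     ≡⟨ cong (binom k l *_) (sym (binom-above (k ∸ l) a k∸l<a)) ⟩
    binom k l * binom (k ∸ l) a ∎
    where
      k∸l<a : k ∸ l < a
      k∸l<a = +-cancelˡ-< l (k ∸ l) a (subst (_< l + a) (sym (m+[n∸m]≡n l≤k)) (≰⇒> l+a≰k))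


module Stirling where

  open import Data.Nat
  open import Data.Nat.Properties
  open import Data.Nat.Tactic.RingSolver
  open import Relation.Binary.PropositionalEquality
  open ≡-Reasoning
  open Sums

  S₂ : ℕ → ℕ → ℕ
  S₂ zero    zero    = 1
  S₂ zero    (suc s) = 0
  S₂ (suc n) zero    = 0
  S₂ (suc n) (suc s) = suc s * S₂ n (suc s) + S₂ n s

  c₁ : ℕ → ℕ → ℕ
  c₁ zero    zero    = 1
  c₁ zero    (suc f) = 0
  c₁ (suc s) zero    = 0
  c₁ (suc s) (suc f) = c₁ s f + s * c₁ s (suc f)

  -- Surjections from a p-set onto an s-set, counted by choosing the (nonempty) preimage of the last point.
  surj : ℕ → ℕ → ℕ
  surj p zero    = isZero p
  surj p (suc s) = Σ< p (λ a → binom p (suc a) * surj (p ∸ suc a) s)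

  c₁-above : ∀ s f → s < f → c₁ s f ≡ 0
  c₁-above zero    (suc f) p = refl
  c₁-above (suc s) (suc f) (s≤s p) =
    trans (cong₂ _+_ (c₁-above s f p) (cong (s *_) (c₁-above s (suc f) (m≤n⇒m≤1+n p)))) (*-zeroʳ s)

  n*c₁[n,0]≡0 : ∀ s → s * c₁ s 0 ≡ 0
  n*c₁[n,0]≡0 zero    = refl
  n*c₁[n,0]≡0 (suc s) = *-zeroʳ (suc s)

  Σ-c₁≡! : ∀ s → Σ< (suc s) (c₁ s) ≡ s !
  Σ-c₁≡! zero    = refl
  Σ-c₁≡! (suc s) = begin
    0 + Σ< (suc s) (λ f → c₁ s f + s * c₁ s (suc f))
      ≡⟨ Σ<-+ (suc s) (c₁ s) (λ f → s * c₁ s (suc f)) ⟩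
    Σ< (suc s) (c₁ s) + Σ< (suc s) (λ f → s * c₁ s (suc f))
      ≡⟨ cong₂ _+_ (Σ-c₁≡! s) (sym (Σ<-*ˡ (suc s) s (λ f → c₁ s (suc f)))) ⟩
    s ! + s * Σ< (suc s) (λ f → c₁ s (suc f))
      ≡⟨ cong (s ! +_) shifted ⟩
    s ! + s * s ! ∎
    where
      shifted : s * Σ< (suc s) (λ f → c₁ s (suc f)) ≡ s * s !
      shifted = begin
        s * Σ< (suc s) (λ f → c₁ s (suc f))
          ≡⟨ cong (_+ s * Σ< (suc s) (λ f → c₁ s (suc f))) (sym (n*c₁[n,0]≡0 s)) ⟩
        s * c₁ s 0 + s * Σ< (suc s) (λ f → c₁ s (suc f))
          ≡⟨ sym (*-distribˡ-+ s _ _) ⟩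
        s * Σ< (suc (suc s)) (c₁ s)
          ≡⟨ cong (s *_) (Σ<-last (suc s) (c₁ s)) ⟩
        s * (Σ< (suc s) (c₁ s) + c₁ s (suc s))
          ≡⟨ cong (λ x → s * (Σ< (suc s) (c₁ s) + x)) (c₁-above s (suc s) ≤-refl) ⟩
        s * (Σ< (suc s) (c₁ s) + 0)
          ≡⟨ cong (s *_) (trans (+-identityʳ _) (Σ-c₁≡! s)) ⟩
        s * s ! ∎

  Σ<-c₁≡! : ∀ s N → s < N → Σ< N (c₁ s) ≡ s !
  Σ<-c₁≡! s N s<N = trans (Σ<-extend (suc s) N (c₁ s) s<N (λ i q → c₁-above s i q)) (Σ-c₁≡! s)

  Σ-binom-c₁ : ∀ s N m → s < N → Σ< N (λ g → binom g m * c₁ s g) ≡ c₁ (suc s) (suc m)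
  Σ-binom-c₁ zero    (suc N) zero    p = cong (1 +_) (Σ<-zero N (λ i _ → *-zeroʳ (binom (suc i) 0)))
  Σ-binom-c₁ zero    (suc N) (suc m) p = Σ<-zero N (λ i _ → *-zeroʳ (binom (suc i) (suc m)))
  Σ-binom-c₁ (suc s) (suc N) m (s≤s p) = begin
    binom 0 m * 0 + Σ< N (λ h → binom (suc h) m * (c₁ s h + s * c₁ s (suc h)))
      ≡⟨ cong₂ _+_ (*-zeroʳ (binom 0 m)) (trans (Σ<-ext N (λ h → *-distribˡ-+ (binom (suc h) m) _ _)) (Σ<-+ N _ _)) ⟩
    0 + (Σ< N (λ h → binom (suc h) m * c₁ s h) + Σ< N (λ h → binom (suc h) m * (s * c₁ s (suc h))))
      ≡⟨ cong (0 +_) (cong₂ _+_ (pascal m) scaled) ⟩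
    0 + ((c₁ (suc s) m + c₁ (suc s) (suc m)) + s * c₁ (suc s) (suc m))
      ≡⟨ +-assoc (c₁ (suc s) m) _ _ ⟩
    c₁ (suc (suc s)) (suc m) ∎
    where
      pascal : ∀ m → Σ< N (λ h → binom (suc h) m * c₁ s h) ≡ c₁ (suc s) m + c₁ (suc s) (suc m)
      pascal zero    = Σ-binom-c₁ s N zero p
      pascal (suc m) = begin
        Σ< N (λ h → (binom h m + binom h (suc m)) * c₁ s h)
          ≡⟨ trans (Σ<-ext N (λ h → *-distribʳ-+ (c₁ s h) (binom h m) _)) (Σ<-+ N _ _) ⟩
        Σ< N (λ g → binom g m * c₁ s g) + Σ< N (λ g → binom g (suc m) * c₁ s g)
          ≡⟨ cong₂ _+_ (Σ-binom-c₁ s N m p) (Σ-binom-c₁ s N (suc m) p) ⟩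
        c₁ (suc s) (suc m) + c₁ (suc s) (suc (suc m)) ∎
      scaled : Σ< N (λ h → binom (suc h) m * (s * c₁ s (suc h))) ≡ s * c₁ (suc s) (suc m)
      scaled = begin
        Σ< N (λ h → binom (suc h) m * (s * c₁ s (suc h)))
          ≡⟨ Σ<-ext N (λ h → x*[y*z]≡y*[x*z] (binom (suc h) m) s (c₁ s (suc h))) ⟩
        Σ< N (λ h → s * (binom (suc h) m * c₁ s (suc h)))
          ≡⟨ sym (Σ<-*ˡ N s _) ⟩
        s * Σ< N (λ h → binom (suc h) m * c₁ s (suc h))
          ≡⟨ cong (_+ s * Σ< N (λ h → binom (suc h) m * c₁ s (suc h))) (sym first-vanishes) ⟩
        s * (binom 0 m * c₁ s 0) + s * Σ< N (λ h → binom (suc h) m * c₁ s (suc h))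
          ≡⟨ sym (*-distribˡ-+ s _ _) ⟩
        s * Σ< (suc N) (λ g → binom g m * c₁ s g)
          ≡⟨ cong (s *_) (Σ-binom-c₁ s (suc N) m (m≤n⇒m≤1+n p)) ⟩
        s * c₁ (suc s) (suc m) ∎
        where
          x*[y*z]≡y*[x*z] : ∀ x y z → x * (y * z) ≡ y * (x * z)
          x*[y*z]≡y*[x*z] = solve-∀
          first-vanishes : s * (binom 0 m * c₁ s 0) ≡ 0
          first-vanishes = trans (x*[y*z]≡y*[x*z] s (binom 0 m) (c₁ s 0))
                                 (trans (cong (binom 0 m *_) (n*c₁[n,0]≡0 s)) (*-zeroʳ (binom 0 m)))

  Σ-binom-c₁-tail : ∀ s k f → s ≤ k → Σ< k (λ b → binom (f + b) (suc b) * c₁ s (f + b)) ≡ s * c₁ s f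
  Σ-binom-c₁-tail s k zero    p =
    trans (Σ<-zero k (λ b _ → cong (_* c₁ s b) (binom-above b (suc b) ≤-refl))) (sym (n*c₁[n,0]≡0 s))
  Σ-binom-c₁-tail s k (suc f) p = +-cancelˡ-≡ (c₁ s f) _ _ (begin
    c₁ s f + Σ< k (λ b → binom (suc f + b) (suc b) * c₁ s (suc f + b))
      ≡⟨ cong (c₁ s f +_) (Σ<-ext k (λ b → trans (cong (λ z → binom z (suc b) * c₁ s z) (sym (+-suc f b)))
                                                  (cong (_* c₁ s (f + suc b)) (sym (binom-sym f (suc b)))))) ⟩
    c₁ s f + Σ< k (λ b → binom (f + suc b) f * c₁ s (f + suc b))
      ≡⟨ sym split ⟩
    Σ< (f + suc k) (λ g → binom g f * c₁ s g)
      ≡⟨ Σ-binom-c₁ s (f + suc k) f (≤-trans (s≤s p) (m≤n+m (suc k) f)) ⟩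
    c₁ s f + s * c₁ s (suc f) ∎)
    where
      diagonal : binom (f + 0) f * c₁ s (f + 0) ≡ c₁ s f
      diagonal rewrite +-identityʳ f | binom-diag f = +-identityʳ (c₁ s f)
      split : Σ< (f + suc k) (λ g → binom g f * c₁ s g) ≡ c₁ s f + Σ< k (λ b → binom (f + suc b) f * c₁ s (f + suc b))
      split = begin
        Σ< (f + suc k) (λ g → binom g f * c₁ s g)
          ≡⟨ Σ<-split f (suc k) (λ g → binom g f * c₁ s g) ⟩
        Σ< f (λ g → binom g f * c₁ s g) + (binom (f + 0) f * c₁ s (f + 0) + Σ< k (λ b → binom (f + suc b) f * c₁ s (f + suc b)))
          ≡⟨ cong₂ _+_ (Σ<-zero f (λ g g<f → cong (_* c₁ s g) (binom-above g f g<f)))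
                       (cong (_+ Σ< k (λ b → binom (f + suc b) f * c₁ s (f + suc b))) diagonal) ⟩
        c₁ s f + Σ< k (λ b → binom (f + suc b) f * c₁ s (f + suc b)) ∎

  Σ-binom-c₁-pred : ∀ t k f → t < k →
    Σ< (suc k) (λ b → binom (f + b ∸ 1) b * b2n (1 ≤ᵇ f + b) * c₁ t (f + b ∸ 1)) ≡ c₁ (suc t) f
  Σ-binom-c₁-pred t k zero p = Σ<-zero (suc k) vanishes
    where
      vanishes : ∀ b → b < suc k → binom (b ∸ 1) b * b2n (1 ≤ᵇ b) * c₁ t (b ∸ 1) ≡ 0
      vanishes zero    _ = refl
      vanishes (suc b) _ = cong (λ x → x * 1 * c₁ t b) (binom-above b (suc b) ≤-refl)
  Σ-binom-c₁-pred t k (suc f) p = begin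
    Σ< (suc k) (λ b → binom (f + b) b * 1 * c₁ t (f + b))
      ≡⟨ Σ<-ext (suc k) (λ b → cong (_* c₁ t (f + b)) (trans (*-identityʳ _) (sym (binom-sym f b)))) ⟩
    Σ< (suc k) (λ b → binom (f + b) f * c₁ t (f + b))
      ≡⟨ cong (_+ Σ< (suc k) (λ b → binom (f + b) f * c₁ t (f + b))) (sym (Σ<-zero f (λ g q → cong (_* c₁ t g) (binom-above g f q)))) ⟩
    Σ< f (λ g → binom g f * c₁ t g) + Σ< (suc k) (λ b → binom (f + b) f * c₁ t (f + b))
      ≡⟨ sym (Σ<-split f (suc k) (λ g → binom g f * c₁ t g)) ⟩
    Σ< (f + suc k) (λ g → binom g f * c₁ t g)
      ≡⟨ Σ-binom-c₁ t (f + suc k) f (≤-trans (m≤n⇒m≤1+n p) (m≤n+m (suc k) f)) ⟩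
    c₁ (suc t) (suc f) ∎

  surj-above : ∀ m s → m < s → surj m s ≡ 0
  surj-above m (suc s) p = Σ<-zero m (λ a a<m →
    trans (cong (binom m (suc a) *_) (surj-above (m ∸ suc a) s (<-≤-trans (∸-monoʳ-< z<s a<m) (≤-pred p))))
          (*-zeroʳ (binom m (suc a))))

  surj-rec : ∀ s n → surj (suc n) (suc s) ≡ suc s * (surj n (suc s) + surj n s)
  surj-rec s n = begin
    Σ< (suc n) (λ a → (binom n a + binom n (suc a)) * surj (n ∸ a) s)
      ≡⟨ trans (Σ<-ext (suc n) (λ a → *-distribʳ-+ (surj (n ∸ a) s) (binom n a) (binom n (suc a))))
               (Σ<-+ (suc n) (λ a → binom n a * surj (n ∸ a) s) (λ a → binom n (suc a) * surj (n ∸ a) s)) ⟩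
    (1 * surj n s + surj n (suc s)) + Σ< (suc n) (λ a → binom n (suc a) * surj (n ∸ a) s)
      ≡⟨ cong ((1 * surj n s + surj n (suc s)) +_) (trans (Σ<-last n _) last-vanishes) ⟩
    (1 * surj n s + surj n (suc s)) + Σ< n (λ a → binom n (suc a) * surj (n ∸ a) s)
      ≡⟨ cong ((1 * surj n s + surj n (suc s)) +_) (shifted s) ⟩
    (1 * surj n s + surj n (suc s)) + s * (surj n (suc s) + surj n s)
      ≡⟨ collect (surj n s) (surj n (suc s)) s ⟩
    suc s * (surj n (suc s) + surj n s) ∎
    where
      collect : ∀ x y s → (1 * x + y) + s * (y + x) ≡ (1 + s) * (y + x)
      collect = solve-∀
      last-vanishes : Σ< n (λ a → binom n (suc a) * surj (n ∸ a) s) + binom n (suc n) * surj (n ∸ n) s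
                    ≡ Σ< n (λ a → binom n (suc a) * surj (n ∸ a) s)
      last-vanishes = trans (cong (λ x → Σ< n (λ a → binom n (suc a) * surj (n ∸ a) s) + x * surj (n ∸ n) s)
                                  (binom-above n (suc n) ≤-refl))
                            (+-identityʳ _)
      shifted : ∀ s → Σ< n (λ a → binom n (suc a) * surj (n ∸ a) s) ≡ s * (surj n (suc s) + surj n s)
      shifted zero    = Σ<-zero n (λ a a<n →
        trans (cong (λ x → binom n (suc a) * surj x 0) (+-∸-assoc 1 a<n)) (*-zeroʳ (binom n (suc a))))
      shifted (suc s) = begin
        Σ< n (λ a → binom n (suc a) * surj (n ∸ a) (suc s))
          ≡⟨ Σ<-cong n (λ a a<n → cong (λ x → binom n (suc a) * surj x (suc s)) (+-∸-assoc 1 a<n)) ⟩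
        Σ< n (λ a → binom n (suc a) * surj (suc (n ∸ suc a)) (suc s))
          ≡⟨ Σ<-ext n (λ a → cong (binom n (suc a) *_) (surj-rec s (n ∸ suc a))) ⟩
        Σ< n (λ a → binom n (suc a) * (suc s * (surj (n ∸ suc a) (suc s) + surj (n ∸ suc a) s)))
          ≡⟨ Σ<-ext n (λ a → distribute (binom n (suc a)) (suc s) (surj (n ∸ suc a) (suc s)) (surj (n ∸ suc a) s)) ⟩
        Σ< n (λ a → suc s * (binom n (suc a) * surj (n ∸ suc a) (suc s)) + suc s * (binom n (suc a) * surj (n ∸ suc a) s))
          ≡⟨ Σ<-+ n _ _ ⟩
        Σ< n (λ a → suc s * (binom n (suc a) * surj (n ∸ suc a) (suc s))) + Σ< n (λ a → suc s * (binom n (suc a) * surj (n ∸ suc a) s))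
          ≡⟨ sym (cong₂ _+_ (Σ<-*ˡ n (suc s) _) (Σ<-*ˡ n (suc s) _)) ⟩
        suc s * surj n (suc (suc s)) + suc s * surj n (suc s)
          ≡⟨ sym (*-distribˡ-+ (suc s) (surj n (suc (suc s))) (surj n (suc s))) ⟩
        suc s * (surj n (suc (suc s)) + surj n (suc s)) ∎
        where
          distribute : ∀ b c x y → b * (c * (x + y)) ≡ c * (b * x) + c * (b * y)
          distribute = solve-∀

  S₂*!≡surj : ∀ n s → S₂ n s * s ! ≡ surj n s
  S₂*!≡surj zero    zero    = refl
  S₂*!≡surj zero    (suc s) = refl
  S₂*!≡surj (suc n) zero    = refl
  S₂*!≡surj (suc n) (suc s) = begin
    (suc s * S₂ n (suc s) + S₂ n s) * (suc s * s !)
      ≡⟨ distribute (suc s) (S₂ n (suc s)) (S₂ n s) (s !) ⟩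
    suc s * (S₂ n (suc s) * (suc s * s !) + S₂ n s * s !)
      ≡⟨ cong (suc s *_) (cong₂ _+_ (S₂*!≡surj n (suc s)) (S₂*!≡surj n s)) ⟩
    suc s * (surj n (suc s) + surj n s)
      ≡⟨ sym (surj-rec s n) ⟩
    surj (suc n) (suc s) ∎
    where
      distribute : ∀ c x y f → (c * x + y) * (c * f) ≡ c * (x * (c * f) + y * f)
      distribute = solve-∀

  Σ-binom-surj : ∀ k l t →
    Σ< k (λ a → binom (l + suc a) (suc a) * (binom k (l + suc a) * surj (k ∸ (l + suc a)) t)) ≡ binom k l * surj (k ∸ l) (suc t)
  Σ-binom-surj k l t = begin
    Σ< k (λ a → binom (l + suc a) (suc a) * (binom k (l + suc a) * surj (k ∸ (l + suc a)) t))
      ≡⟨ Σ<-ext k (λ a → trans (sym (*-assoc (binom (l + suc a) (suc a)) _ _))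
                               (cong₂ _*_ (binom-subset-of-subset l (suc a) k) (cong (λ z → surj z t) (sym (∸-+-assoc k l (suc a)))))) ⟩
    Σ< k (λ a → binom k l * binom (k ∸ l) (suc a) * surj (k ∸ l ∸ suc a) t)
      ≡⟨ Σ<-ext k (λ a → *-assoc (binom k l) _ _) ⟩
    Σ< k (λ a → binom k l * (binom (k ∸ l) (suc a) * surj (k ∸ l ∸ suc a) t))
      ≡⟨ sym (Σ<-*ˡ k (binom k l) _) ⟩
    binom k l * Σ< k (λ a → binom (k ∸ l) (suc a) * surj (k ∸ l ∸ suc a) t)
      ≡⟨ cong (binom k l *_) (Σ<-extend (k ∸ l) k _ (m∸n≤m k l) (λ i q → cong (_* surj (k ∸ l ∸ suc i) t) (binom-above (k ∸ l) (suc i) (s≤s q)))) ⟩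
    binom k l * surj (k ∸ l) (suc t) ∎


module FinCounting where

  open import Data.Nat using (ℕ; zero; suc; _+_; _*_; _≤_; _<_; z≤n; s≤s; _<ᵇ_)
  import Data.Nat.Properties as ℕP
  open import Data.Nat.Tactic.RingSolver
  open import Data.Bool as B using (Bool; true; false; _∧_; _∨_; not)
  import Data.Bool.Properties as BP
  open import Data.Fin as Fin using (Fin; inject₁; fromℕ)
  open import Data.List using (List; []; _∷_; map; concatMap; filter; length; tabulate; _++_)
  open import Data.Bool.ListAction using (all; any)
  open import Relation.Binary.PropositionalEquality
  open ≡-Reasoning
  open Sums

  b2n-∧ : ∀ a b → b2n (a ∧ b) ≡ b2n a * b2n b
  b2n-∧ true  b = sym (ℕP.+-identityʳ (b2n b))
  b2n-∧ false b = refl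

  b2n-not : ∀ a → b2n (not a) ≡ isZero (b2n a)
  b2n-not true  = refl
  b2n-not false = refl

  cntF : ∀ {n} → (Fin n → Bool) → ℕ
  cntF {zero}  P = 0
  cntF {suc n} P = b2n (P Fin.zero) + cntF (λ i → P (Fin.suc i))

  allF : ∀ {n} → (Fin n → Bool) → Bool
  allF {zero}  P = true
  allF {suc n} P = P Fin.zero ∧ allF (λ i → P (Fin.suc i))

  anyF : ∀ {n} → (Fin n → Bool) → Bool
  anyF {zero}  P = false
  anyF {suc n} P = P Fin.zero ∨ anyF (λ i → P (Fin.suc i))

  cntF-ext : ∀ {n} {P Q : Fin n → Bool} → (∀ i → P i ≡ Q i) → cntF P ≡ cntF Q
  cntF-ext {zero}  h = refl
  cntF-ext {suc n} h = cong₂ _+_ (cong b2n (h Fin.zero)) (cntF-ext (λ i → h (Fin.suc i)))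

  allF-ext : ∀ {n} {P Q : Fin n → Bool} → (∀ i → P i ≡ Q i) → allF P ≡ allF Q
  allF-ext {zero}  h = refl
  allF-ext {suc n} h = cong₂ _∧_ (h Fin.zero) (allF-ext (λ i → h (Fin.suc i)))

  anyF-ext : ∀ {n} {P Q : Fin n → Bool} → (∀ i → P i ≡ Q i) → anyF P ≡ anyF Q
  anyF-ext {zero}  h = refl
  anyF-ext {suc n} h = cong₂ _∨_ (h Fin.zero) (anyF-ext (λ i → h (Fin.suc i)))

  cntF-snoc : ∀ {n} (P : Fin (suc n) → Bool) → cntF P ≡ cntF (λ i → P (inject₁ i)) + b2n (P (fromℕ n))
  cntF-snoc {zero}  P = ℕP.+-comm (b2n (P Fin.zero)) 0
  cntF-snoc {suc n} P =
    trans (cong (b2n (P Fin.zero) +_) (cntF-snoc (λ i → P (Fin.suc i)))) (sym (ℕP.+-assoc (b2n (P Fin.zero)) _ _))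

  allF-snoc : ∀ {n} (P : Fin (suc n) → Bool) → allF P ≡ allF (λ i → P (inject₁ i)) ∧ P (fromℕ n)
  allF-snoc {zero} P with P Fin.zero
  ... | true  = refl
  ... | false = refl
  allF-snoc {suc n} P rewrite allF-snoc (λ i → P (Fin.suc i)) with P Fin.zero
  ... | true  = refl
  ... | false = refl

  anyF-snoc : ∀ {n} (P : Fin (suc n) → Bool) → anyF P ≡ anyF (λ i → P (inject₁ i)) ∨ P (fromℕ n)
  anyF-snoc {zero} P with P Fin.zero
  ... | true  = refl
  ... | false = refl
  anyF-snoc {suc n} P rewrite anyF-snoc (λ i → P (Fin.suc i)) with P Fin.zero
  ... | true  = refl
  ... | false = refl

  allF-true : ∀ {n} (P : Fin n → Bool) → allF P ≡ true → ∀ i → P i ≡ true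
  allF-true {suc n} P h Fin.zero with P Fin.zero | h
  ... | true | _ = refl
  allF-true {suc n} P h (Fin.suc i) with P Fin.zero | h
  ... | true | h' = allF-true (λ i → P (Fin.suc i)) h' i

  allF-intro : ∀ {n} (P : Fin n → Bool) → (∀ i → P i ≡ true) → allF P ≡ true
  allF-intro {zero}  P h = refl
  allF-intro {suc n} P h rewrite h Fin.zero = allF-intro (λ i → P (Fin.suc i)) (λ i → h (Fin.suc i))

  allF-const : ∀ {n} → allF {n} (λ _ → true) ≡ true
  allF-const {n} = allF-intro {n} (λ _ → true) (λ _ → refl)

  anyF-false : ∀ {n} (P : Fin n → Bool) → (∀ i → P i ≡ false) → anyF P ≡ false
  anyF-false {zero}  P h = refl
  anyF-false {suc n} P h rewrite h Fin.zero = anyF-false (λ i → P (Fin.suc i)) (λ i → h (Fin.suc i))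

  allF-∧ : ∀ {n} (P Q : Fin n → Bool) → allF (λ i → P i ∧ Q i) ≡ allF P ∧ allF Q
  allF-∧ {zero}  P Q = refl
  allF-∧ {suc n} P Q rewrite allF-∧ (λ i → P (Fin.suc i)) (λ i → Q (Fin.suc i)) with P Fin.zero | Q Fin.zero
  ... | true  | true  = refl
  ... | true  | false = sym (BP.∧-zeroʳ _)
  ... | false | _     = refl

  allF-comm : ∀ {n m} (P : Fin n → Fin m → Bool) → allF (λ i → allF (λ j → P i j)) ≡ allF (λ j → allF (λ i → P i j))
  allF-comm {zero}  {m} P = sym (allF-const {m})
  allF-comm {suc n} {m} P = begin
    allF (λ j → P Fin.zero j) ∧ allF (λ i → allF (λ j → P (Fin.suc i) j))
      ≡⟨ cong (allF (λ j → P Fin.zero j) ∧_) (allF-comm (λ i j → P (Fin.suc i) j)) ⟩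
    allF (λ j → P Fin.zero j) ∧ allF (λ j → allF (λ i → P (Fin.suc i) j))
      ≡⟨ sym (allF-∧ (λ j → P Fin.zero j) (λ j → allF (λ i → P (Fin.suc i) j))) ⟩
    allF (λ j → P Fin.zero j ∧ allF (λ i → P (Fin.suc i) j)) ∎

  not-∧-anyF : ∀ {n} a (P : Fin n → Bool) → not (a ∧ anyF P) ≡ allF (λ i → not (a ∧ P i))
  not-∧-anyF {zero}  true  P = refl
  not-∧-anyF {zero}  false P = refl
  not-∧-anyF {suc n} false P = sym (allF-const {suc n})
  not-∧-anyF {suc n} true  P with P Fin.zero
  ... | true  = refl
  ... | false = not-∧-anyF true (λ i → P (Fin.suc i))

  allF-not≡not-anyF : ∀ {k} (P : Fin k → Bool) → allF (λ j → not (P j)) ≡ not (anyF P)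
  allF-not≡not-anyF {zero}  P = refl
  allF-not≡not-anyF {suc k} P with P Fin.zero
  ... | true  = refl
  ... | false = allF-not≡not-anyF (λ j → P (Fin.suc j))

  b2n-anyF : ∀ {k} (P : Fin k → Bool) → b2n (anyF P) ≡ isPos (cntF P)
  b2n-anyF {zero}  P = refl
  b2n-anyF {suc k} P with P Fin.zero
  ... | true  = refl
  ... | false = b2n-anyF (λ i → P (Fin.suc i))

  cntF-const : ∀ {n} → cntF {n} (λ _ → true) ≡ n
  cntF-const {zero}  = refl
  cntF-const {suc n} = cong suc (cntF-const {n})

  cntF-false : ∀ {n} → cntF {n} (λ _ → false) ≡ 0
  cntF-false {zero}  = refl
  cntF-false {suc n} = cntF-false {n}

  cntF-≤ : ∀ {n} (P : Fin n → Bool) → cntF P ≤ n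
  cntF-≤ {zero}  P = z≤n
  cntF-≤ {suc n} P with P Fin.zero
  ... | true  = s≤s (cntF-≤ (λ i → P (Fin.suc i)))
  ... | false = ℕP.m≤n⇒m≤1+n (cntF-≤ (λ i → P (Fin.suc i)))

  cntF-partition : ∀ {k} (P Q : Fin k → Bool) → cntF (λ j → P j ∧ not (Q j)) + cntF (λ j → Q j ∧ P j) ≡ cntF P
  cntF-partition {zero}  P Q = refl
  cntF-partition {suc k} P Q with P Fin.zero | Q Fin.zero
  ... | true  | true  = trans (ℕP.+-suc _ _) (cong suc (cntF-partition (λ j → P (Fin.suc j)) (λ j → Q (Fin.suc j))))
  ... | true  | false = cong suc (cntF-partition (λ j → P (Fin.suc j)) (λ j → Q (Fin.suc j)))
  ... | false | true  = cntF-partition (λ j → P (Fin.suc j)) (λ j → Q (Fin.suc j))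
  ... | false | false = cntF-partition (λ j → P (Fin.suc j)) (λ j → Q (Fin.suc j))

  m<n⇒m<ᵇn≡true : ∀ {m n} → m < n → (m <ᵇ n) ≡ true
  m<n⇒m<ᵇn≡true {zero}  {suc n} p       = refl
  m<n⇒m<ᵇn≡true {suc m} {suc n} (s≤s p) = m<n⇒m<ᵇn≡true p

  n≤m⇒m<ᵇn≡false : ∀ {m n} → n ≤ m → (m <ᵇ n) ≡ false
  n≤m⇒m<ᵇn≡false {m}     {zero}  p       = refl
  n≤m⇒m<ᵇn≡false {suc m} {suc n} (s≤s p) = n≤m⇒m<ᵇn≡false p

  filter-tabulate : ∀ {A : Set} {n} (Q : A → Bool) (f : Fin n → A) →
    length (filter (λ x → Q x B.≟ true) (tabulate f)) ≡ cntF (λ i → Q (f i))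
  filter-tabulate {n = zero}  Q f = refl
  filter-tabulate {n = suc n} Q f with Q (f Fin.zero)
  ... | true  = cong suc (filter-tabulate Q (λ i → f (Fin.suc i)))
  ... | false = filter-tabulate Q (λ i → f (Fin.suc i))

  all-tabulate : ∀ {A : Set} {n} (Q : A → Bool) (f : Fin n → A) → all Q (tabulate f) ≡ allF (λ i → Q (f i))
  all-tabulate {n = zero}  Q f = refl
  all-tabulate {n = suc n} Q f = cong (Q (f Fin.zero) ∧_) (all-tabulate Q (λ i → f (Fin.suc i)))

  any-tabulate : ∀ {A : Set} {n} (Q : A → Bool) (f : Fin n → A) → any Q (tabulate f) ≡ anyF (λ i → Q (f i))
  any-tabulate {n = zero}  Q f = refl
  any-tabulate {n = suc n} Q f = cong (Q (f Fin.zero) ∨_) (any-tabulate Q (λ i → f (Fin.suc i)))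

  sumL : ∀ {A : Set} → (A → ℕ) → List A → ℕ
  sumL f []       = 0
  sumL f (x ∷ xs) = f x + sumL f xs

  length-filter : ∀ {A : Set} (P : A → Bool) xs → length (filter (λ x → P x B.≟ true) xs) ≡ sumL (λ x → b2n (P x)) xs
  length-filter P [] = refl
  length-filter P (x ∷ xs) with P x
  ... | true  = cong suc (length-filter P xs)
  ... | false = length-filter P xs

  sumL-ext : ∀ {A : Set} {f g : A → ℕ} xs → (∀ x → f x ≡ g x) → sumL f xs ≡ sumL g xs
  sumL-ext []       h = refl
  sumL-ext (x ∷ xs) h = cong₂ _+_ (h x) (sumL-ext xs h)

  sumL-++ : ∀ {A : Set} (f : A → ℕ) xs ys → sumL f (xs ++ ys) ≡ sumL f xs + sumL f ys
  sumL-++ f []       ys = refl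
  sumL-++ f (x ∷ xs) ys = trans (cong (f x +_) (sumL-++ f xs ys)) (sym (ℕP.+-assoc (f x) _ _))

  sumL-map : ∀ {A C : Set} (f : C → ℕ) (g : A → C) xs → sumL f (map g xs) ≡ sumL (λ x → f (g x)) xs
  sumL-map f g []       = refl
  sumL-map f g (x ∷ xs) = cong (f (g x) +_) (sumL-map f g xs)

  sumL-concatMap : ∀ {A C : Set} (f : C → ℕ) (g : A → List C) xs →
    sumL f (concatMap g xs) ≡ sumL (λ x → sumL f (g x)) xs
  sumL-concatMap f g []       = refl
  sumL-concatMap f g (x ∷ xs) =
    trans (sumL-++ f (g x) (concatMap g xs)) (cong (sumL f (g x) +_) (sumL-concatMap f g xs))

  sumL-+ : ∀ {A : Set} (f g : A → ℕ) xs → sumL (λ x → f x + g x) xs ≡ sumL f xs + sumL g xs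
  sumL-+ f g [] = refl
  sumL-+ f g (x ∷ xs) rewrite sumL-+ f g xs = +-interchange (f x) (g x) (sumL f xs) (sumL g xs)
    where
      +-interchange : ∀ a b c d → a + b + (c + d) ≡ a + c + (b + d)
      +-interchange = solve-∀

  sumL-*ˡ : ∀ {A : Set} c (f : A → ℕ) xs → c * sumL f xs ≡ sumL (λ x → c * f x) xs
  sumL-*ˡ c f []       = ℕP.*-zeroʳ c
  sumL-*ˡ c f (x ∷ xs) = trans (ℕP.*-distribˡ-+ c (f x) _) (cong (c * f x +_) (sumL-*ˡ c f xs))

  sumL-Σ< : ∀ {A : Set} N (g : A → ℕ → ℕ) xs → sumL (λ x → Σ< N (g x)) xs ≡ Σ< N (λ a → sumL (λ x → g x a) xs)
  sumL-Σ< N g []       = sym (Σ<-zero N (λ _ _ → refl))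
  sumL-Σ< N g (x ∷ xs) = trans (cong (Σ< N (g x) +_) (sumL-Σ< N g xs)) (sym (Σ<-+ N (g x) (λ a → sumL (λ x → g x a) xs)))


module RowProfile where

  open import Data.Nat using (ℕ; zero; suc; _+_; _*_; _≤_; _<_; s≤s)
  import Data.Nat.Properties as ℕP
  open import Data.Nat.Tactic.RingSolver
  open import Data.Bool using (Bool; true; false; _∧_; _∨_; not)
  open import Data.Fin as Fin using (Fin)
  open import Data.Vec using (Vec; []; _∷_; lookup)
  open import Data.List using ([]; _∷_)
  open import Relation.Binary.PropositionalEquality
  open ≡-Reasoning
  open Sums
  open FinCounting

  module _ {k : ℕ} (z b : Fin k → Bool) where

    free : Fin k → Bool
    free j = not (z j) ∧ not (b j)

    admissible : Vec Bool k → Bool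
    admissible r = allF (λ j → not (lookup r j ∧ b j))

    #onZero : Vec Bool k → ℕ
    #onZero r = cntF (λ j → lookup r j ∧ z j)

    #onFree : Vec Bool k → ℕ
    #onFree r = cntF (λ j → lookup r j ∧ free j)

    oneAfter : Vec Bool k → Fin k → Bool
    oneAfter r j = anyF (λ j' → (j <F j') ∧ lookup r j')

    #free′ : Vec Bool k → ℕ
    #free′ r = cntF (λ j → not (z j ∧ not (lookup r j)) ∧ not (b j ∨ (lookup r j ∧ oneAfter r j)))

  isPos-+suc : ∀ a b → isPos (a + suc b) ≡ 1
  isPos-+suc a b rewrite ℕP.+-suc a b = refl

  isZero-isPos : ∀ n → isZero (isPos n) ≡ isZero n
  isZero-isPos zero    = refl
  isZero-isPos (suc n) = refl

  nonempty-admissible : ∀ {k} (z b : Fin k → Bool) (r : Vec Bool k) → admissible z b r ≡ true →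
    b2n (anyF (lookup r)) ≡ isPos (#onZero z b r + #onFree z b r)
  nonempty-admissible {zero}  z b []          a = refl
  nonempty-admissible {suc k} z b (false ∷ r) a =
    nonempty-admissible (λ j → z (Fin.suc j)) (λ j → b (Fin.suc j)) r a
  nonempty-admissible {suc k} z b (true ∷ r)  a with b Fin.zero | a
  ... | false | _ with z Fin.zero
  ...   | true  = refl
  ...   | false = sym (isPos-+suc (cntF (λ j → lookup r j ∧ z (Fin.suc j))) _)

  empty-admissible : ∀ {k} (z b : Fin k → Bool) r → admissible z b r ≡ true →
    b2n (allF (λ j → not (lookup r j))) ≡ isZero (#onZero z b r + #onFree z b r)
  empty-admissible z b r a = begin
    b2n (allF (λ j → not (lookup r j)))                 ≡⟨ cong b2n (allF-not≡not-anyF (lookup r)) ⟩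
    b2n (not (anyF (lookup r)))                         ≡⟨ b2n-not (anyF (lookup r)) ⟩
    isZero (b2n (anyF (lookup r)))                      ≡⟨ cong isZero (nonempty-admissible z b r a) ⟩
    isZero (isPos (#onZero z b r + #onFree z b r))      ≡⟨ isZero-isPos _ ⟩
    isZero (#onZero z b r + #onFree z b r) ∎

  -- A column the row misses keeps its status; of the columns it hits, all become blocked except the last one,
  -- which is free whether it was zero or free before.
  #free′≡ : ∀ {k} (z b : Fin k → Bool) (r : Vec Bool k) → admissible z b r ≡ true →
    #free′ z b r ≡ cntF (λ j → free z b j ∧ not (lookup r j)) + b2n (anyF (lookup r))
  #free′≡ {zero}  z b []          a = refl
  #free′≡ {suc k} z b (false ∷ r) a =
    trans (cong₂ _+_ (cong b2n (missed (z Fin.zero) (b Fin.zero))) (#free′≡ z′ b′ r a))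
          (sym (ℕP.+-assoc (b2n (free z b Fin.zero ∧ true)) (cntF (λ j → free z′ b′ j ∧ not (lookup r j))) (b2n (anyF (lookup r)))))
    where
      z′ = λ j → z (Fin.suc j)
      b′ = λ j → b (Fin.suc j)
      missed : ∀ x y → not (x ∧ true) ∧ not (y ∨ false) ≡ (not x ∧ not y) ∧ not false
      missed true  y     = refl
      missed false true  = refl
      missed false false = refl
  #free′≡ {suc k} z b (true ∷ r) a with b Fin.zero | a
  ... | false | a′ =
    trans (cong (b2n (not (z Fin.zero ∧ false) ∧ not (anyF (lookup r))) +_) (#free′≡ (λ j → z (Fin.suc j)) (λ j → b (Fin.suc j)) r a′))
          (hit (z Fin.zero) (anyF (lookup r)) _)
    where
      1+n≡n+1 : ∀ n → suc (n + 0) ≡ n + 1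
      1+n≡n+1 n = trans (cong suc (ℕP.+-identityʳ n)) (ℕP.+-comm 1 n)
      hit : ∀ x later C → b2n (not (x ∧ false) ∧ not later) + (C + b2n later) ≡ b2n ((not x ∧ true) ∧ false) + C + 1
      hit true  true  C = refl
      hit false true  C = refl
      hit true  false C = 1+n≡n+1 C
      hit false false C = 1+n≡n+1 C

  #free′-admissible : ∀ {k} (z b : Fin k → Bool) (r : Vec Bool k) → admissible z b r ≡ true →
    #free′ z b r + #onFree z b r ≡ cntF (free z b) + isPos (#onZero z b r + #onFree z b r)
  #free′-admissible z b r a = begin
    #free′ z b r + #onFree z b r
      ≡⟨ cong (_+ #onFree z b r) (#free′≡ z b r a) ⟩
    cntF (λ j → free z b j ∧ not (lookup r j)) + b2n (anyF (lookup r)) + #onFree z b r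
      ≡⟨ x+y+z≡x+z+y (cntF (λ j → free z b j ∧ not (lookup r j))) (b2n (anyF (lookup r))) (#onFree z b r) ⟩
    cntF (λ j → free z b j ∧ not (lookup r j)) + #onFree z b r + b2n (anyF (lookup r))
      ≡⟨ cong₂ _+_ (cntF-partition (free z b) (lookup r)) (nonempty-admissible z b r a) ⟩
    cntF (free z b) + isPos (#onZero z b r + #onFree z b r) ∎
    where
      x+y+z≡x+z+y : ∀ x y z → x + y + z ≡ x + z + y
      x+y+z≡x+z+y = solve-∀

  Σ<-pascal-full : ∀ N Z (G : ℕ → ℕ) → Z < N →
    Σ< (suc N) (λ a → binom (suc Z) a * G a) ≡ Σ< (suc N) (λ a → binom Z a * G a) + Σ< (suc N) (λ a → binom Z a * G (suc a))
  Σ<-pascal-full N Z G Z<N = trans (Σ<-pascal N Z G) (cong (Σ< (suc N) (λ a → binom Z a * G a) +_) (sym (begin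
    Σ< (suc N) (λ a → binom Z a * G (suc a))          ≡⟨ Σ<-last N (λ a → binom Z a * G (suc a)) ⟩
    Σ< N (λ a → binom Z a * G (suc a)) + binom Z N * G (suc N)
      ≡⟨ cong (λ x → Σ< N (λ a → binom Z a * G (suc a)) + x * G (suc N)) (binom-above Z N Z<N) ⟩
    Σ< N (λ a → binom Z a * G (suc a)) + 0            ≡⟨ ℕP.+-identityʳ _ ⟩
    Σ< N (λ a → binom Z a * G (suc a)) ∎)))

  binomWeighted : ℕ → ℕ → ℕ → (ℕ → ℕ → ℕ) → ℕ
  binomWeighted N Z F ψ = Σ< (suc N) (λ a → binom Z a * Σ< (suc N) (λ c → binom F c * ψ a c))

  binomWeighted-sucˡ : ∀ N Z F ψ → Z < N →
    binomWeighted N (suc Z) F ψ ≡ binomWeighted N Z F ψ + binomWeighted N Z F (λ a c → ψ (suc a) c)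
  binomWeighted-sucˡ N Z F ψ = Σ<-pascal-full N Z (λ a → Σ< (suc N) (λ c → binom F c * ψ a c))

  binomWeighted-sucʳ : ∀ N Z F ψ → F < N →
    binomWeighted N Z (suc F) ψ ≡ binomWeighted N Z F ψ + binomWeighted N Z F (λ a c → ψ a (suc c))
  binomWeighted-sucʳ N Z F ψ F<N = begin
    Σ< (suc N) (λ a → binom Z a * Σ< (suc N) (λ c → binom (suc F) c * ψ a c))
      ≡⟨ Σ<-ext (suc N) (λ a → cong (binom Z a *_) (Σ<-pascal-full N F (ψ a) F<N)) ⟩
    Σ< (suc N) (λ a → binom Z a * (Σ< (suc N) (λ c → binom F c * ψ a c) + Σ< (suc N) (λ c → binom F c * ψ a (suc c))))
      ≡⟨ Σ<-ext (suc N) (λ a → ℕP.*-distribˡ-+ (binom Z a) (Σ< (suc N) (λ c → binom F c * ψ a c)) (Σ< (suc N) (λ c → binom F c * ψ a (suc c)))) ⟩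
    Σ< (suc N) (λ a → binom Z a * Σ< (suc N) (λ c → binom F c * ψ a c) + binom Z a * Σ< (suc N) (λ c → binom F c * ψ a (suc c)))
      ≡⟨ Σ<-+ (suc N) (λ a → binom Z a * Σ< (suc N) (λ c → binom F c * ψ a c))
                      (λ a → binom Z a * Σ< (suc N) (λ c → binom F c * ψ a (suc c))) ⟩
    binomWeighted N Z F ψ + binomWeighted N Z F (λ a c → ψ a (suc c)) ∎

  -- An admissible row is an arbitrary choice of a set of zero columns and a set of free columns.
  Σ-admissible-rows : ∀ k N (z b : Fin k → Bool) → (∀ j → z j ∧ b j ≡ false) → k ≤ N → (ψ : ℕ → ℕ → ℕ) →
    sumL (λ r → b2n (admissible z b r) * ψ (#onZero z b r) (#onFree z b r)) (allVecs k)
      ≡ binomWeighted N (cntF z) (cntF (free z b)) ψ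
  Σ-admissible-rows zero N z b _ _ ψ = begin
    1 * ψ 0 0 + 0                            ≡⟨ trans (ℕP.+-identityʳ _) (ℕP.*-identityˡ _) ⟩
    ψ 0 0                                    ≡⟨ sym (trans (ℕP.+-identityʳ _) (ℕP.*-identityˡ _)) ⟩
    1 * ψ 0 0 + 0                            ≡⟨ cong (1 * ψ 0 0 +_) (sym (Σ<-zero N (λ _ _ → refl))) ⟩
    1 * ψ 0 0 + Σ< N (λ c → 0 * ψ 0 (suc c)) ≡⟨ sym (ℕP.*-identityˡ _) ⟩
    1 * (1 * ψ 0 0 + Σ< N (λ c → 0 * ψ 0 (suc c)))
      ≡⟨ sym (trans (cong (1 * (1 * ψ 0 0 + Σ< N (λ c → 0 * ψ 0 (suc c))) +_) (Σ<-zero N (λ _ _ → refl))) (ℕP.+-identityʳ _)) ⟩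
    binomWeighted N 0 0 ψ ∎
  Σ-admissible-rows (suc k) N z b disjoint k<N ψ = begin
    sumL φ (allVecs (suc k))
      ≡⟨ sumL-concatMap φ (λ v → (false ∷ v) ∷ (true ∷ v) ∷ []) (allVecs k) ⟩
    sumL (λ v → φ (false ∷ v) + (φ (true ∷ v) + 0)) (allVecs k)
      ≡⟨ by-first-column (z Fin.zero) (b Fin.zero) refl refl ⟩
    binomWeighted N (b2n (z Fin.zero) + cntF z′) (b2n (free z b Fin.zero) + cntF (free z′ b′)) ψ ∎
    where
      z′ = λ j → z (Fin.suc j)
      b′ = λ j → b (Fin.suc j)
      φ : Vec Bool (suc k) → ℕ
      φ r = b2n (admissible z b r) * ψ (#onZero z b r) (#onFree z b r)
      IH : ∀ ψ → sumL (λ r → b2n (admissible z′ b′ r) * ψ (#onZero z′ b′ r) (#onFree z′ b′ r)) (allVecs k)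
                 ≡ binomWeighted N (cntF z′) (cntF (free z′ b′)) ψ
      IH = Σ-admissible-rows k N z′ b′ (λ j → disjoint (Fin.suc j)) (ℕP.≤-trans (ℕP.n≤1+n k) k<N)
      W′ : (ℕ → ℕ → ℕ) → ℕ
      W′ = binomWeighted N (cntF z′) (cntF (free z′ b′))
      Z′<N : cntF z′ < N
      Z′<N = ℕP.<-≤-trans (s≤s (cntF-≤ z′)) k<N
      F′<N : cntF (free z′ b′) < N
      F′<N = ℕP.<-≤-trans (s≤s (cntF-≤ (free z′ b′))) k<N
      both-entries : ∀ ψ′ → (∀ v → φ (true ∷ v) ≡ b2n (admissible z′ b′ v) * ψ′ (#onZero z′ b′ v) (#onFree z′ b′ v)) →
        sumL (λ v → φ (false ∷ v) + (φ (true ∷ v) + 0)) (allVecs k) ≡ W′ ψ + W′ ψ′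
      both-entries ψ′ on-first =
        trans (sumL-ext (allVecs k) (λ v → cong (φ (false ∷ v) +_) (trans (ℕP.+-identityʳ _) (on-first v))))
              (trans (sumL-+ (λ v → φ (false ∷ v)) (λ v → b2n (admissible z′ b′ v) * ψ′ (#onZero z′ b′ v) (#onFree z′ b′ v)) (allVecs k))
                     (cong₂ _+_ (IH ψ) (IH ψ′)))
      by-first-column : ∀ x y → z Fin.zero ≡ x → b Fin.zero ≡ y →
        sumL (λ v → φ (false ∷ v) + (φ (true ∷ v) + 0)) (allVecs k) ≡
        binomWeighted N (b2n x + cntF z′) (b2n (not x ∧ not y) + cntF (free z′ b′)) ψ
      by-first-column true true ez eb with () ← trans (sym (cong₂ _∧_ ez eb)) (disjoint Fin.zero)
      by-first-column true false ez eb =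
        trans (both-entries (λ a c → ψ (suc a) c) on-zero-column)
              (sym (binomWeighted-sucˡ N (cntF z′) (cntF (free z′ b′)) ψ Z′<N))
        where
          on-zero-column : ∀ v → φ (true ∷ v) ≡ b2n (admissible z′ b′ v) * ψ (suc (#onZero z′ b′ v)) (#onFree z′ b′ v)
          on-zero-column v rewrite ez | eb = refl
      by-first-column false false ez eb =
        trans (both-entries (λ a c → ψ a (suc c)) on-free-column)
              (sym (binomWeighted-sucʳ N (cntF z′) (cntF (free z′ b′)) ψ F′<N))
        where
          on-free-column : ∀ v → φ (true ∷ v) ≡ b2n (admissible z′ b′ v) * ψ (#onZero z′ b′ v) (suc (#onFree z′ b′ v))
          on-free-column v rewrite ez | eb = refl
      by-first-column false true ez eb =
        trans (sumL-ext (allVecs k) (λ v → trans (cong (φ (false ∷ v) +_) (trans (ℕP.+-identityʳ _) (on-blocked-column v)))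
                                                 (ℕP.+-identityʳ _)))
              (IH ψ)
        where
          on-blocked-column : ∀ v → φ (true ∷ v) ≡ 0
          on-blocked-column v rewrite ez | eb = refl

module MatrixStatistics where

  open import Data.Nat using (ℕ; suc; _+_)
  import Data.Nat.Properties as ℕP
  open import Data.Bool using (Bool; true; false; _∧_; _∨_; not)
  import Data.Bool.Properties as BP
  open import Data.Fin as Fin using (Fin; inject₁; fromℕ)
  import Data.Fin.Properties as FinP
  open import Data.Vec using (Vec; []; _∷_; lookup; _∷ʳ_)
  open import Data.List using (allFin)
  open import Data.Bool.ListAction using (all; any)
  open import Relation.Binary.PropositionalEquality
  open ≡-Reasoning
  open Sums using (b2n)
  open FinCounting
  open RowProfile using (admissible)

  private variable n k : ℕ

  noΓ : Matrix n k → Bool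
  noΓ m = allF λ i → allF λ i' → allF λ j → allF λ j' →
    not ((i <F i') ∧ (j <F j') ∧ entry m i j ∧ entry m i j' ∧ entry m i' j)

  zeroCol : Matrix n k → Fin k → Bool
  zeroCol m j = allF (λ i → not (entry m i j))

  zeroRow : Matrix n k → Fin n → Bool
  zeroRow m i = allF (λ j → not (entry m i j))

  top1 : Matrix n k → Fin n → Fin k → Bool
  top1 m i j = entry m i j ∧ allF (λ i' → not ((i' <F i) ∧ entry m i' j))

  -- A column is blocked when it has a 1 with another 1 to its right: no 1 may ever be placed below it.
  blocked : Matrix n k → Fin k → Bool
  blocked m j = anyF (λ i → entry m i j ∧ anyF (λ j' → (j <F j') ∧ entry m i j'))

  #top #zeroRows #zeroCols #free : Matrix n k → ℕ
  #top m      = cntF (λ i → anyF (λ j → top1 m i j))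
  #zeroRows m = cntF (zeroRow m)
  #zeroCols m = cntF (zeroCol m)
  #free m     = cntF (λ j → not (zeroCol m j) ∧ not (blocked m j))

  Γ-free≡noΓ : (m : Matrix n k) → Γ-free m ≡ noΓ m
  Γ-free≡noΓ {n} {k} m =
    trans (all-tabulate (λ i → all (λ i' → all (λ j → all (λ j' → body i i' j j') (allFin k)) (allFin k)) (allFin n)) (λ i → i))
    (allF-ext (λ i → trans (all-tabulate (λ i' → all (λ j → all (λ j' → body i i' j j') (allFin k)) (allFin k)) (λ i → i))
    (allF-ext (λ i' → trans (all-tabulate (λ j → all (λ j' → body i i' j j') (allFin k)) (λ i → i))
    (allF-ext (λ j → all-tabulate (λ j' → body i i' j j') (λ i → i)))))))
    where
      body : Fin n → Fin n → Fin k → Fin k → Bool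
      body i i' j j' = not ((i <F i') ∧ (j <F j') ∧ entry m i j ∧ entry m i j' ∧ entry m i' j)

  rₑ≡#zeroRows : (m : Matrix n k) → rₑ m ≡ #zeroRows m
  rₑ≡#zeroRows {n} {k} m = trans (filter-tabulate (λ i → all (λ j → not (entry m i j)) (allFin k)) (λ i → i))
    (cntF-ext (λ i → all-tabulate (λ j → not (entry m i j)) (λ i → i)))

  cₑ≡#zeroCols : (m : Matrix n k) → cₑ m ≡ #zeroCols m
  cₑ≡#zeroCols {n} {k} m = trans (filter-tabulate (λ j → all (λ i → not (entry m i j)) (allFin n)) (λ i → i))
    (cntF-ext (λ j → all-tabulate (λ i → not (entry m i j)) (λ i → i)))

  rₜ≡#top : (m : Matrix n k) → rₜ m ≡ #top m
  rₜ≡#top {n} {k} m = trans (filter-tabulate (λ i → any (λ j → isTop1 m i j) (allFin k)) (λ i → i))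
    (cntF-ext (λ i → trans (any-tabulate (λ j → isTop1 m i j) (λ i → i))
      (anyF-ext (λ j → cong (entry m i j ∧_) (all-tabulate (λ i' → not ((i' <F i) ∧ entry m i' j)) (λ i → i))))))

  zeroCol∧blocked≡false : (m : Matrix n k) (j : Fin k) → zeroCol m j ∧ blocked m j ≡ false
  zeroCol∧blocked≡false m j with zeroCol m j in eq
  ... | false = refl
  ... | true  = anyF-false _ (λ i → no-one i (allF-true _ eq i))
    where
      no-one : ∀ i → not (entry m i j) ≡ true → (entry m i j ∧ anyF (λ j' → (j <F j') ∧ entry m i j')) ≡ false
      no-one i _ with entry m i j
      ... | false = refl

  <F-inject₁ : ∀ {n} (i i' : Fin n) → (inject₁ i <F inject₁ i') ≡ (i <F i')
  <F-inject₁ i i' rewrite FinP.toℕ-inject₁ i | FinP.toℕ-inject₁ i' = refl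

  inject₁<Flast : ∀ {n} (i : Fin n) → (inject₁ i <F fromℕ n) ≡ true
  inject₁<Flast {n} i rewrite FinP.toℕ-inject₁ i | FinP.toℕ-fromℕ n = m<n⇒m<ᵇn≡true (FinP.toℕ<n i)

  last≮F : ∀ {n} (x : Fin (suc n)) → (fromℕ n <F x) ≡ false
  last≮F {n} x rewrite FinP.toℕ-fromℕ n = n≤m⇒m<ᵇn≡false (ℕP.≤-pred (FinP.toℕ<n x))

  lookup-∷ʳ-inject₁ : ∀ {A : Set} {n} (M : Vec A n) (r : A) (i : Fin n) → lookup (M ∷ʳ r) (inject₁ i) ≡ lookup M i
  lookup-∷ʳ-inject₁ (x ∷ M) r Fin.zero    = refl
  lookup-∷ʳ-inject₁ (x ∷ M) r (Fin.suc i) = lookup-∷ʳ-inject₁ M r i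

  lookup-∷ʳ-last : ∀ {A : Set} {n} (M : Vec A n) (r : A) → lookup (M ∷ʳ r) (fromℕ n) ≡ r
  lookup-∷ʳ-last []      r = refl
  lookup-∷ʳ-last (x ∷ M) r = lookup-∷ʳ-last M r

  ∧-shuffle : ∀ a b c d → a ∧ b ∧ c ∧ d ≡ (d ∧ b) ∧ (a ∧ c)
  ∧-shuffle true  true  true  d = sym (trans (BP.∧-identityʳ (d ∧ true)) (BP.∧-identityʳ d))
  ∧-shuffle true  true  false d = sym (BP.∧-zeroʳ (d ∧ true))
  ∧-shuffle true  false c     d = sym (cong (_∧ c) (BP.∧-zeroʳ d))
  ∧-shuffle false b     c     d = sym (BP.∧-zeroʳ (d ∧ b))

  module AppendRow {n k : ℕ} (M : Matrix n k) (r : Vec Bool k) where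

    M⁺ : Matrix (suc n) k
    M⁺ = M ∷ʳ r

    entry-inject₁ : ∀ i j → entry M⁺ (inject₁ i) j ≡ entry M i j
    entry-inject₁ i j = cong (λ v → lookup v j) (lookup-∷ʳ-inject₁ M r i)

    entry-last : ∀ j → entry M⁺ (fromℕ n) j ≡ lookup r j
    entry-last j = cong (λ v → lookup v j) (lookup-∷ʳ-last M r)

    zeroCol-append : ∀ j → zeroCol M⁺ j ≡ zeroCol M j ∧ not (lookup r j)
    zeroCol-append j = trans (allF-snoc (λ x → not (entry M⁺ x j)))
      (cong₂ _∧_ (allF-ext (λ i → cong not (entry-inject₁ i j))) (cong not (entry-last j)))

    #zeroRows-append : #zeroRows M⁺ ≡ #zeroRows M + b2n (allF (λ j → not (lookup r j)))
    #zeroRows-append = trans (cntF-snoc (zeroRow M⁺))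
      (cong₂ _+_ (cntF-ext (λ i → allF-ext (λ j → cong not (entry-inject₁ i j))))
                 (cong b2n (allF-ext (λ j → cong not (entry-last j)))))

    above-last : ∀ (x : Fin (suc n)) j → not ((fromℕ n <F x) ∧ entry M⁺ (fromℕ n) j) ≡ true
    above-last x j = cong (λ a → not (a ∧ entry M⁺ (fromℕ n) j)) (last≮F x)

    top1-inject₁ : ∀ i j → top1 M⁺ (inject₁ i) j ≡ top1 M i j
    top1-inject₁ i j = cong₂ _∧_ (entry-inject₁ i j) (begin
      allF (λ x → not ((x <F inject₁ i) ∧ entry M⁺ x j))
        ≡⟨ allF-snoc (λ x → not ((x <F inject₁ i) ∧ entry M⁺ x j)) ⟩
      allF (λ i' → not ((inject₁ i' <F inject₁ i) ∧ entry M⁺ (inject₁ i') j)) ∧ not ((fromℕ n <F inject₁ i) ∧ entry M⁺ (fromℕ n) j)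
        ≡⟨ cong₂ _∧_ (allF-ext (λ i' → cong₂ (λ a b → not (a ∧ b)) (<F-inject₁ i' i) (entry-inject₁ i' j))) (above-last (inject₁ i) j) ⟩
      allF (λ i' → not ((i' <F i) ∧ entry M i' j)) ∧ true
        ≡⟨ BP.∧-identityʳ _ ⟩
      allF (λ i' → not ((i' <F i) ∧ entry M i' j)) ∎)

    top1-last : ∀ j → top1 M⁺ (fromℕ n) j ≡ lookup r j ∧ zeroCol M j
    top1-last j = cong₂ _∧_ (entry-last j) (begin
      allF (λ x → not ((x <F fromℕ n) ∧ entry M⁺ x j))
        ≡⟨ allF-snoc (λ x → not ((x <F fromℕ n) ∧ entry M⁺ x j)) ⟩
      allF (λ i' → not ((inject₁ i' <F fromℕ n) ∧ entry M⁺ (inject₁ i') j)) ∧ not ((fromℕ n <F fromℕ n) ∧ entry M⁺ (fromℕ n) j)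
        ≡⟨ cong₂ _∧_ (allF-ext (λ i' → cong₂ (λ a b → not (a ∧ b)) (inject₁<Flast i') (entry-inject₁ i' j))) (above-last (fromℕ n) j) ⟩
      zeroCol M j ∧ true
        ≡⟨ BP.∧-identityʳ _ ⟩
      zeroCol M j ∎)

    #top-append : #top M⁺ ≡ #top M + b2n (anyF (λ j → lookup r j ∧ zeroCol M j))
    #top-append = trans (cntF-snoc (λ x → anyF (λ j → top1 M⁺ x j)))
      (cong₂ _+_ (cntF-ext (λ i → anyF-ext (top1-inject₁ i))) (cong b2n (anyF-ext top1-last)))

    blocked-append : ∀ j → blocked M⁺ j ≡ blocked M j ∨ (lookup r j ∧ anyF (λ j' → (j <F j') ∧ lookup r j'))
    blocked-append j = trans (anyF-snoc (λ x → entry M⁺ x j ∧ anyF (λ j' → (j <F j') ∧ entry M⁺ x j')))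
      (cong₂ _∨_ (anyF-ext (λ i → cong₂ _∧_ (entry-inject₁ i j) (anyF-ext (λ j' → cong ((j <F j') ∧_) (entry-inject₁ i j')))))
                 (cong₂ _∧_ (entry-last j) (anyF-ext (λ j' → cong ((j <F j') ∧_) (entry-last j')))))

    noΓ-append : noΓ M⁺ ≡ noΓ M ∧ admissible (zeroCol M) (blocked M) r
    noΓ-append = begin
      noΓ M⁺
        ≡⟨ allF-snoc Γ⁺ ⟩
      allF (λ i → Γ⁺ (inject₁ i)) ∧ Γ⁺ (fromℕ n)
        ≡⟨ cong₂ _∧_ (allF-ext split) last-row ⟩
      allF (λ i → Γ i ∧ withLast i) ∧ true
        ≡⟨ trans (BP.∧-identityʳ _) (allF-∧ Γ withLast) ⟩
      noΓ M ∧ allF withLast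
        ≡⟨ cong (noΓ M ∧_) withLast≡admissible ⟩
      noΓ M ∧ admissible (zeroCol M) (blocked M) r ∎
      where
        Γ⁺ : Fin (suc n) → Bool
        Γ⁺ x = allF λ x' → allF λ j → allF λ j' → not ((x <F x') ∧ (j <F j') ∧ entry M⁺ x j ∧ entry M⁺ x j' ∧ entry M⁺ x' j)
        Γ : Fin n → Bool
        Γ i = allF λ i' → allF λ j → allF λ j' → not ((i <F i') ∧ (j <F j') ∧ entry M i j ∧ entry M i j' ∧ entry M i' j)
        withLast : Fin n → Bool
        withLast i = allF λ j → allF λ j' → not (true ∧ (j <F j') ∧ entry M i j ∧ entry M i j' ∧ lookup r j)
        split : ∀ i → Γ⁺ (inject₁ i) ≡ Γ i ∧ withLast i
        split i = trans (allF-snoc (λ x' → allF λ j → allF λ j' →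
                           not ((inject₁ i <F x') ∧ (j <F j') ∧ entry M⁺ (inject₁ i) j ∧ entry M⁺ (inject₁ i) j' ∧ entry M⁺ x' j)))
          (cong₂ _∧_
            (allF-ext (λ i' → allF-ext (λ j → allF-ext (λ j' → cong not
               (cong₂ _∧_ (<F-inject₁ i i') (cong ((j <F j') ∧_) (cong₂ _∧_ (entry-inject₁ i j) (cong₂ _∧_ (entry-inject₁ i j') (entry-inject₁ i' j)))))))))
            (allF-ext (λ j → allF-ext (λ j' → cong not
               (cong₂ _∧_ (inject₁<Flast i) (cong ((j <F j') ∧_) (cong₂ _∧_ (entry-inject₁ i j) (cong₂ _∧_ (entry-inject₁ i j') (entry-last j)))))))))
        last-row : Γ⁺ (fromℕ n) ≡ true
        last-row = allF-intro _ (λ x' → allF-intro _ (λ j → allF-intro _ (λ j' →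
          cong (λ a → not (a ∧ ((j <F j') ∧ entry M⁺ (fromℕ n) j ∧ entry M⁺ (fromℕ n) j' ∧ entry M⁺ x' j))) (last≮F x'))))
        withLast≡admissible : allF withLast ≡ admissible (zeroCol M) (blocked M) r
        withLast≡admissible = begin
          allF (λ i → allF (λ j → allF (λ j' → not (true ∧ (j <F j') ∧ entry M i j ∧ entry M i j' ∧ lookup r j))))
            ≡⟨ allF-comm (λ i j → allF (λ j' → not (true ∧ (j <F j') ∧ entry M i j ∧ entry M i j' ∧ lookup r j))) ⟩
          allF (λ j → allF (λ i → allF (λ j' → not (true ∧ (j <F j') ∧ entry M i j ∧ entry M i j' ∧ lookup r j))))
            ≡⟨ allF-ext (λ j → allF-ext (λ i → allF-ext (λ j' → cong not (∧-shuffle (j <F j') (entry M i j) (entry M i j') (lookup r j))))) ⟩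
          allF (λ j → allF (λ i → allF (λ j' → not ((lookup r j ∧ entry M i j) ∧ ((j <F j') ∧ entry M i j')))))
            ≡⟨ allF-ext (λ j → allF-ext (λ i → sym (not-∧-anyF (lookup r j ∧ entry M i j) (λ j' → (j <F j') ∧ entry M i j')))) ⟩
          allF (λ j → allF (λ i → not ((lookup r j ∧ entry M i j) ∧ anyF (λ j' → (j <F j') ∧ entry M i j'))))
            ≡⟨ allF-ext (λ j → allF-ext (λ i → cong not (BP.∧-assoc (lookup r j) (entry M i j) _))) ⟩
          allF (λ j → allF (λ i → not (lookup r j ∧ (entry M i j ∧ anyF (λ j' → (j <F j') ∧ entry M i j')))))
            ≡⟨ allF-ext (λ j → sym (not-∧-anyF (lookup r j) (λ i → entry M i j ∧ anyF (λ j' → (j <F j') ∧ entry M i j')))) ⟩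
          admissible (zeroCol M) (blocked M) r ∎


module ClosedForm where

  open import Data.Nat
  open import Data.Nat.Properties
  open import Data.Nat.Tactic.RingSolver
  open import Relation.Binary.PropositionalEquality
  open import Relation.Nullary using (¬_; Dec; yes; no)
  open ≡-Reasoning
  open Sums
  open Stirling

  rowFactor : ℕ → ℕ → ℕ → ℕ
  rowFactor n j s = binom n j * S₂ (n ∸ j) s

  colFactor : ℕ → ℕ → ℕ → ℕ
  colFactor k l s = binom k l * surj (k ∸ l) s

  closedForm : ℕ → ℕ → ℕ → ℕ → ℕ → ℕ → ℕ
  closedForm n k s j l f = rowFactor n j s * colFactor k l s * c₁ s f

  -- The weight with which a count for n rows with statistics (s − [a > 0], j − [a + c = 0], l + a, f + c − [a + c > 0])
  -- contributes, when a new row with a ones on zero columns and c ones on free columns is appended.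
  transition : ℕ → ℕ → ℕ → ℕ → ℕ → ℕ → ℕ
  transition s j l f a c =
    binom (l + a) a * binom (f + c ∸ isPos (a + c)) c
      * (b2n (isPos a ≤ᵇ s) * b2n (isZero (a + c) ≤ᵇ j) * b2n (isPos (a + c) ≤ᵇ f + c))

  rowFactor-rec : ∀ n j s →
    rowFactor (suc n) j s ≡ b2n (1 ≤ᵇ j) * rowFactor n (j ∸ 1) s + s * rowFactor n j s + b2n (1 ≤ᵇ s) * rowFactor n j (s ∸ 1)
  rowFactor-rec n zero zero    = refl
  rowFactor-rec n zero (suc s) = rearrange s (S₂ n (suc s)) (S₂ n s)
    where
      rearrange : ∀ s x y → 1 * (suc s * x + y) ≡ 0 + suc s * (1 * x) + 1 * (1 * y)
      rearrange = solve-∀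
  rowFactor-rec n (suc j) s = begin
    (binom n j + binom n (suc j)) * S₂ (n ∸ j) s
      ≡⟨ *-distribʳ-+ (S₂ (n ∸ j) s) (binom n j) (binom n (suc j)) ⟩
    binom n j * S₂ (n ∸ j) s + binom n (suc j) * S₂ (n ∸ j) s
      ≡⟨ cong (binom n j * S₂ (n ∸ j) s +_) (new-zero-row (suc j ≤? n) s) ⟩
    binom n j * S₂ (n ∸ j) s + (s * rowFactor n (suc j) s + b2n (1 ≤ᵇ s) * rowFactor n (suc j) (s ∸ 1))
      ≡⟨ rearrange (binom n j * S₂ (n ∸ j) s) (s * rowFactor n (suc j) s) (b2n (1 ≤ᵇ s) * rowFactor n (suc j) (s ∸ 1)) ⟩
    1 * (binom n j * S₂ (n ∸ j) s) + s * rowFactor n (suc j) s + b2n (1 ≤ᵇ s) * rowFactor n (suc j) (s ∸ 1) ∎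
    where
      rearrange : ∀ x y z → x + (y + z) ≡ 1 * x + y + z
      rearrange = solve-∀
      new-zero-row : Dec (suc j ≤ n) → ∀ s →
        binom n (suc j) * S₂ (n ∸ j) s ≡ s * rowFactor n (suc j) s + b2n (1 ≤ᵇ s) * rowFactor n (suc j) (s ∸ 1)
      new-zero-row (yes j<n) zero = trans (cong (λ z → binom n (suc j) * S₂ z 0) (+-∸-assoc 1 j<n)) (*-zeroʳ (binom n (suc j)))
      new-zero-row (yes j<n) (suc s) = begin
        binom n (suc j) * S₂ (n ∸ j) (suc s)
          ≡⟨ cong (λ z → binom n (suc j) * S₂ z (suc s)) (+-∸-assoc 1 j<n) ⟩
        binom n (suc j) * (suc s * S₂ (n ∸ suc j) (suc s) + S₂ (n ∸ suc j) s)
          ≡⟨ distribute (binom n (suc j)) s (S₂ (n ∸ suc j) (suc s)) (S₂ (n ∸ suc j) s) ⟩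
        suc s * (binom n (suc j) * S₂ (n ∸ suc j) (suc s)) + 1 * (binom n (suc j) * S₂ (n ∸ suc j) s) ∎
        where
          distribute : ∀ b s x y → b * (suc s * x + y) ≡ suc s * (b * x) + 1 * (b * y)
          distribute = solve-∀
      new-zero-row (no j≮n) s = begin
        binom n (suc j) * S₂ (n ∸ j) s
          ≡⟨ cong (_* S₂ (n ∸ j) s) binom≡0 ⟩
        0
          ≡⟨ sym (cong₂ _+_ (trans (cong (λ z → s * (z * S₂ (n ∸ suc j) s)) binom≡0) (*-zeroʳ s))
                            (trans (cong (λ z → b2n (1 ≤ᵇ s) * (z * S₂ (n ∸ suc j) (s ∸ 1))) binom≡0) (*-zeroʳ (b2n (1 ≤ᵇ s))))) ⟩
        s * rowFactor n (suc j) s + b2n (1 ≤ᵇ s) * rowFactor n (suc j) (s ∸ 1) ∎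
        where
          binom≡0 = binom-above n (suc j) (≰⇒> j≮n)

  colFactor-above : ∀ k l s → ¬ (s ≤ k) → colFactor k l s ≡ 0
  colFactor-above k l s s≰k =
    trans (cong (binom k l *_) (surj-above (k ∸ l) s (≤-<-trans (m∸n≤m k l) (≰⇒> s≰k)))) (*-zeroʳ (binom k l))

  Σ<²-factor : ∀ N M K (A B : ℕ → ℕ) → Σ< N (λ a → Σ< M (λ b → K * A a * B b)) ≡ K * Σ< N A * Σ< M B
  Σ<²-factor N M K A B = begin
    Σ< N (λ a → Σ< M (λ b → K * A a * B b)) ≡⟨ Σ<-ext N (λ a → sym (Σ<-*ˡ M (K * A a) B)) ⟩
    Σ< N (λ a → K * A a * Σ< M B)           ≡⟨ Σ<-ext N (λ a → x*y*z≡x*z*y K (A a) (Σ< M B)) ⟩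
    Σ< N (λ a → (K * Σ< M B) * A a)         ≡⟨ sym (Σ<-*ˡ N (K * Σ< M B) A) ⟩
    (K * Σ< M B) * Σ< N A                   ≡⟨ x*y*z≡x*z*y K (Σ< M B) (Σ< N A) ⟩
    K * Σ< N A * Σ< M B ∎
    where
      x*y*z≡x*z*y : ∀ x y z → x * y * z ≡ x * z * y
      x*y*z≡x*z*y = solve-∀

  step : ℕ → ℕ → ℕ → ℕ → ℕ → ℕ → ℕ → ℕ → ℕ
  step n k s j l f a c =
    transition s j l f a c * closedForm n k (s ∸ isPos a) (j ∸ isZero (a + c)) (l + a) (f + c ∸ isPos (a + c))

  Σ-step-split : ∀ n k s j l f →
    Σ< (suc k) (λ a → Σ< (suc k) (step n k s j l f a)) ≡
      b2n (1 ≤ᵇ j) * rowFactor n (j ∸ 1) s * colFactor k l s * c₁ s f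
      + rowFactor n j s * colFactor k l s * Σ< k (λ c → binom (f + c) (suc c) * c₁ s (f + c))
      + b2n (1 ≤ᵇ s) * rowFactor n j (s ∸ 1) * colFactor k l (suc (s ∸ 1))
          * Σ< (suc k) (λ c → binom (f + c ∸ 1) c * b2n (1 ≤ᵇ f + c) * c₁ (s ∸ 1) (f + c ∸ 1))
  Σ-step-split n k s j l f = begin
    (step n k s j l f 0 0 + Σ< k (λ c → step n k s j l f 0 (suc c))) + Σ< k (λ a → Σ< (suc k) (step n k s j l f (suc a)))
      ≡⟨ cong₂ _+_ (cong₂ _+_ empty-row (trans (Σ<-ext k free-only) (sym (Σ<-*ˡ k (rowFactor n j s * colFactor k l s) _))))
                   (trans (Σ<-ext k (λ a → Σ<-ext (suc k) (hits-zero a)))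
                          (Σ<²-factor k (suc k) (b2n (1 ≤ᵇ s) * rowFactor n j (s ∸ 1))
                                      (λ a → binom (l + suc a) (suc a) * colFactor k (l + suc a) (s ∸ 1))
                                      (λ c → binom (f + c ∸ 1) c * b2n (1 ≤ᵇ f + c) * c₁ (s ∸ 1) (f + c ∸ 1)))) ⟩
    E + F + b2n (1 ≤ᵇ s) * rowFactor n j (s ∸ 1) * Σ< k (λ a → binom (l + suc a) (suc a) * colFactor k (l + suc a) (s ∸ 1)) * G
      ≡⟨ cong (λ z → E + F + b2n (1 ≤ᵇ s) * rowFactor n j (s ∸ 1) * z * G) (Σ-binom-surj k l (s ∸ 1)) ⟩
    E + F + b2n (1 ≤ᵇ s) * rowFactor n j (s ∸ 1) * colFactor k l (suc (s ∸ 1)) * G ∎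
    where
      E = b2n (1 ≤ᵇ j) * rowFactor n (j ∸ 1) s * colFactor k l s * c₁ s f
      F = rowFactor n j s * colFactor k l s * Σ< k (λ c → binom (f + c) (suc c) * c₁ s (f + c))
      G = Σ< (suc k) (λ c → binom (f + c ∸ 1) c * b2n (1 ≤ᵇ f + c) * c₁ (s ∸ 1) (f + c ∸ 1))
      empty-row : step n k s j l f 0 0 ≡ b2n (1 ≤ᵇ j) * rowFactor n (j ∸ 1) s * colFactor k l s * c₁ s f
      empty-row rewrite +-identityʳ l | +-identityʳ f = rearrange (b2n (1 ≤ᵇ j)) (rowFactor n (j ∸ 1) s) (colFactor k l s) (c₁ s f)
        where
          rearrange : ∀ a b c d → 1 * 1 * (1 * a * 1) * (b * c * d) ≡ a * b * c * d
          rearrange = solve-∀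
      free-only : ∀ c → step n k s j l f 0 (suc c) ≡ rowFactor n j s * colFactor k l s * (binom (f + c) (suc c) * c₁ s (f + c))
      free-only c rewrite +-identityʳ l | +-suc f c = rearrange (binom (f + c) (suc c)) (rowFactor n j s) (colFactor k l s) (c₁ s (f + c))
        where
          rearrange : ∀ a b c d → 1 * a * (1 * 1 * 1) * (b * c * d) ≡ b * c * (a * d)
          rearrange = solve-∀
      hits-zero : ∀ a c → step n k s j l f (suc a) c ≡
        b2n (1 ≤ᵇ s) * rowFactor n j (s ∸ 1) * (binom (l + suc a) (suc a) * colFactor k (l + suc a) (s ∸ 1))
          * (binom (f + c ∸ 1) c * b2n (1 ≤ᵇ f + c) * c₁ (s ∸ 1) (f + c ∸ 1))
      hits-zero a c = rearrange (binom (l + suc a) (suc a)) (binom (f + c ∸ 1) c) (b2n (1 ≤ᵇ s)) (b2n (1 ≤ᵇ f + c))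
                                (rowFactor n j (s ∸ 1)) (colFactor k (l + suc a) (s ∸ 1)) (c₁ (s ∸ 1) (f + c ∸ 1))
        where
          rearrange : ∀ A B x y r c d → A * B * (x * 1 * y) * (r * c * d) ≡ x * r * (A * c) * (B * y * d)
          rearrange = solve-∀

  closedForm-rec : ∀ n k s j l f → Σ< (suc k) (λ a → Σ< (suc k) (step n k s j l f a)) ≡ closedForm (suc n) k s j l f
  closedForm-rec n k s j l f = trans (Σ-step-split n k s j l f) (by-cases s (s ≤? k))
    where
      by-cases : ∀ s → Dec (s ≤ k) →
        b2n (1 ≤ᵇ j) * rowFactor n (j ∸ 1) s * colFactor k l s * c₁ s f
        + rowFactor n j s * colFactor k l s * Σ< k (λ c → binom (f + c) (suc c) * c₁ s (f + c))
        + b2n (1 ≤ᵇ s) * rowFactor n j (s ∸ 1) * colFactor k l (suc (s ∸ 1))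
            * Σ< (suc k) (λ c → binom (f + c ∸ 1) c * b2n (1 ≤ᵇ f + c) * c₁ (s ∸ 1) (f + c ∸ 1))
        ≡ closedForm (suc n) k s j l f
      by-cases zero (yes s≤k) rewrite Σ-binom-c₁-tail 0 k f s≤k = begin
        b2n (1 ≤ᵇ j) * rowFactor n (j ∸ 1) 0 * colFactor k l 0 * c₁ 0 f + rowFactor n j 0 * colFactor k l 0 * 0 + 0
          ≡⟨ rearrange (b2n (1 ≤ᵇ j) * rowFactor n (j ∸ 1) 0) (rowFactor n j 0) (colFactor k l 0) (c₁ 0 f) ⟩
        (b2n (1 ≤ᵇ j) * rowFactor n (j ∸ 1) 0 + 0 * rowFactor n j 0 + 0 * rowFactor n j (0 ∸ 1)) * colFactor k l 0 * c₁ 0 f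
          ≡⟨ cong (λ z → z * colFactor k l 0 * c₁ 0 f) (sym (rowFactor-rec n j 0)) ⟩
        closedForm (suc n) k 0 j l f ∎
        where
          rearrange : ∀ a b c d → a * c * d + b * c * 0 + 0 ≡ (a + 0 * b + 0 * 0) * c * d
          rearrange = solve-∀
      by-cases (suc t) (yes s≤k) rewrite Σ-binom-c₁-tail (suc t) k f s≤k | Σ-binom-c₁-pred t k f s≤k = begin
        b2n (1 ≤ᵇ j) * rowFactor n (j ∸ 1) (suc t) * colFactor k l (suc t) * c₁ (suc t) f
          + rowFactor n j (suc t) * colFactor k l (suc t) * (suc t * c₁ (suc t) f)
          + 1 * rowFactor n j t * colFactor k l (suc t) * c₁ (suc t) f
          ≡⟨ rearrange (b2n (1 ≤ᵇ j) * rowFactor n (j ∸ 1) (suc t)) (rowFactor n j (suc t)) (rowFactor n j t) (colFactor k l (suc t)) (c₁ (suc t) f) t ⟩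
        (b2n (1 ≤ᵇ j) * rowFactor n (j ∸ 1) (suc t) + suc t * rowFactor n j (suc t) + 1 * rowFactor n j t) * colFactor k l (suc t) * c₁ (suc t) f
          ≡⟨ cong (λ z → z * colFactor k l (suc t) * c₁ (suc t) f) (sym (rowFactor-rec n j (suc t))) ⟩
        closedForm (suc n) k (suc t) j l f ∎
        where
          rearrange : ∀ a b r c d t → a * c * d + b * c * (suc t * d) + 1 * r * c * d ≡ (a + suc t * b + 1 * r) * c * d
          rearrange = solve-∀
      by-cases zero    (no s≰k) with () ← s≰k z≤n
      by-cases (suc t) (no s≰k) rewrite colFactor-above k l (suc t) s≰k =
        vanish (b2n (1 ≤ᵇ j) * rowFactor n (j ∸ 1) (suc t)) (rowFactor n j (suc t)) (rowFactor n j t) (c₁ (suc t) f) _ _ (rowFactor (suc n) j (suc t))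
        where
          vanish : ∀ a b r d x y z → a * 0 * d + b * 0 * x + 1 * r * 0 * y ≡ z * 0 * d
          vanish = solve-∀

  countFormula : ℕ → ℕ → ℕ → ℕ → ℕ → ℕ
  countFormula i j l n k = binom n j * binom k l * (surj (n ∸ j) i * surj (k ∸ l) i)

  Σ-closedForm : ∀ n k i j l → Σ< (suc k) (closedForm n k i j l) ≡ countFormula i j l n k
  Σ-closedForm n k i j l = trans (sym (Σ<-*ˡ (suc k) (rowFactor n j i * colFactor k l i) (c₁ i))) (by-cases (i ≤? k))
    where
      by-cases : Dec (i ≤ k) → rowFactor n j i * colFactor k l i * Σ< (suc k) (c₁ i) ≡ countFormula i j l n k
      by-cases (yes i≤k) = begin
        rowFactor n j i * colFactor k l i * Σ< (suc k) (c₁ i)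
          ≡⟨ cong (rowFactor n j i * colFactor k l i *_) (Σ<-c₁≡! i (suc k) (s≤s i≤k)) ⟩
        binom n j * S₂ (n ∸ j) i * (binom k l * surj (k ∸ l) i) * i !
          ≡⟨ rearrange (binom n j) (S₂ (n ∸ j) i) (binom k l) (surj (k ∸ l) i) (i !) ⟩
        binom n j * binom k l * (S₂ (n ∸ j) i * i ! * surj (k ∸ l) i)
          ≡⟨ cong (λ t → binom n j * binom k l * (t * surj (k ∸ l) i)) (S₂*!≡surj (n ∸ j) i) ⟩
        countFormula i j l n k ∎
        where
          rearrange : ∀ a b c d e → a * b * (c * d) * e ≡ a * c * (b * e * d)
          rearrange = solve-∀
      by-cases (no i≰k) =
        trans (cong (λ t → rowFactor n j i * (binom k l * t) * Σ< (suc k) (c₁ i)) surj≡0)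
              (trans (vanish (rowFactor n j i) (binom k l) (Σ< (suc k) (c₁ i)) (binom n j) (surj (n ∸ j) i))
                     (cong (λ t → binom n j * binom k l * (surj (n ∸ j) i * t)) (sym surj≡0)))
        where
          surj≡0 : surj (k ∸ l) i ≡ 0
          surj≡0 = surj-above (k ∸ l) i (≤-<-trans (m∸n≤m k l) (≰⇒> i≰k))
          vanish : ∀ r b s a x → r * (b * 0) * s ≡ a * b * (x * 0)
          vanish = solve-∀


module RefinedCount where

  open import Data.Nat using (ℕ; zero; suc; _+_; _*_; _∸_; _≡ᵇ_; _≤ᵇ_; _<_; s≤s)
  import Data.Nat.Properties as ℕP
  open import Data.Nat.Tactic.RingSolver
  open import Data.Bool using (Bool; true; false; _∧_; not; T)
  import Data.Bool.Properties as BP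
  open import Data.Vec using (Vec; []; _∷_; _∷ʳ_; lookup)
  open import Data.List using ([]; _∷_; map; concatMap)
  open import Relation.Binary.PropositionalEquality
  open ≡-Reasoning
  open Sums
  open Stirling using (surj)
  open FinCounting
  open RowProfile
  open MatrixStatistics
  open ClosedForm

  private variable n k : ℕ

  hasStats : Matrix n k → ℕ → ℕ → ℕ → ℕ → Bool
  hasStats M s j l f = noΓ M ∧ ((#top M ≡ᵇ s) ∧ ((#zeroRows M ≡ᵇ j) ∧ ((#zeroCols M ≡ᵇ l) ∧ (#free M ≡ᵇ f))))

  refinedCount : ℕ → ℕ → ℕ → ℕ → ℕ → ℕ → ℕ
  refinedCount n k s j l f = sumL (λ M → b2n (hasStats M s j l f)) (allMatrices n k)

  sumL-allMatrices-suc : ∀ n k (φ : Matrix (suc n) k → ℕ) →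
    sumL φ (allMatrices (suc n) k) ≡ sumL (λ M → sumL (λ r → φ (M ∷ʳ r)) (allVecs k)) (allMatrices n k)
  sumL-allMatrices-suc zero k φ =
    trans (sumL-concatMap φ (λ r → map (λ m → r ∷ m) (allMatrices 0 k)) (allVecs k))
          (trans (sumL-ext (allVecs k) (λ r → ℕP.+-identityʳ (φ (r ∷ []))))
                 (sym (ℕP.+-identityʳ (sumL (λ r → φ (r ∷ [])) (allVecs k)))))
  sumL-allMatrices-suc (suc n) k φ = begin
    sumL φ (concatMap (λ r → map (λ m → r ∷ m) (allMatrices (suc n) k)) (allVecs k))
      ≡⟨ sumL-concatMap φ (λ r → map (λ m → r ∷ m) (allMatrices (suc n) k)) (allVecs k) ⟩
    sumL (λ r₀ → sumL φ (map (λ m → r₀ ∷ m) (allMatrices (suc n) k))) (allVecs k)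
      ≡⟨ sumL-ext (allVecs k) (λ r₀ → trans (sumL-map φ (λ m → r₀ ∷ m) (allMatrices (suc n) k))
                                            (sumL-allMatrices-suc n k (λ m → φ (r₀ ∷ m)))) ⟩
    sumL (λ r₀ → sumL (λ M → sumL (λ r → φ (r₀ ∷ (M ∷ʳ r))) (allVecs k)) (allMatrices n k)) (allVecs k)
      ≡⟨ sym (trans (sumL-concatMap (λ M → sumL (λ r → φ (M ∷ʳ r)) (allVecs k)) (λ r → map (λ m → r ∷ m) (allMatrices n k)) (allVecs k))
                    (sumL-ext (allVecs k) (λ r₀ → sumL-map (λ M → sumL (λ r → φ (M ∷ʳ r)) (allVecs k)) (λ m → r₀ ∷ m) (allMatrices n k)))) ⟩
    sumL (λ M → sumL (λ r → φ (M ∷ʳ r)) (allVecs k)) (allMatrices (suc n) k) ∎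

  -- Whether appending a row with a ones on zero columns and c ones on free columns turns M into a Γ-free matrix
  -- with the statistics (s, j, l, f).
  appendedStats : Matrix n k → ℕ → ℕ → ℕ → ℕ → ℕ → ℕ → ℕ
  appendedStats M s j l f a c =
    b2n (noΓ M ∧ ((#top M + isPos a ≡ᵇ s) ∧ ((#zeroRows M + isZero (a + c) ≡ᵇ j)
                ∧ ((#zeroCols M ≡ᵇ l + a) ∧ (#free M + isPos (a + c) ≡ᵇ f + c)))))

  hasStats-append : (M : Matrix n k) (r : Vec Bool k) → ∀ s j l f →
    b2n (hasStats (M ∷ʳ r) s j l f) ≡
      b2n (admissible (zeroCol M) (blocked M) r) * appendedStats M s j l f (#onZero (zeroCol M) (blocked M) r) (#onFree (zeroCol M) (blocked M) r)
  hasStats-append M r s j l f with admissible (zeroCol M) (blocked M) r in adm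
  ... | false rewrite AppendRow.noΓ-append M r | adm | BP.∧-zeroʳ (noΓ M) = refl
  ... | true  rewrite AppendRow.noΓ-append M r | adm | BP.∧-identityʳ (noΓ M) =
    trans (cong (λ t → b2n (noΓ M ∧ t)) (cong₂ _∧_ top (cong₂ _∧_ zeroRows (cong₂ _∧_ zeroCols frees)))) (sym (ℕP.+-identityʳ _))
    where
      open AppendRow M r
      z = zeroCol M
      b = blocked M
      A = #onZero z b r
      B = #onFree z b r
      top : (#top M⁺ ≡ᵇ s) ≡ (#top M + isPos A ≡ᵇ s)
      top = cong (_≡ᵇ s) (trans #top-append (cong (#top M +_) (b2n-anyF (λ j → lookup r j ∧ z j))))
      zeroRows : (#zeroRows M⁺ ≡ᵇ j) ≡ (#zeroRows M + isZero (A + B) ≡ᵇ j)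
      zeroRows = cong (_≡ᵇ j) (trans #zeroRows-append (cong (#zeroRows M +_) (empty-admissible z b r adm)))
      zeroCols : (#zeroCols M⁺ ≡ᵇ l) ≡ (#zeroCols M ≡ᵇ l + A)
      zeroCols = trans (sym (+-cancelʳ-≡ᵇ (#zeroCols M⁺) l A))
                       (cong (_≡ᵇ l + A) (trans (cong (_+ A) (cntF-ext zeroCol-append)) (cntF-partition z (lookup r))))
      frees : (#free M⁺ ≡ᵇ f) ≡ (#free M + isPos (A + B) ≡ᵇ f + B)
      frees = trans (sym (+-cancelʳ-≡ᵇ (#free M⁺) f B))
                   (cong (_≡ᵇ f + B) (trans (cong (_+ B) (cntF-ext (λ j → cong₂ (λ x y → not x ∧ not y) (zeroCol-append j) (blocked-append j))))
                                            (#free′-admissible z b r adm)))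

  Σ-hasStats-append : (M : Matrix n k) → ∀ s j l f →
    sumL (λ r → b2n (hasStats (M ∷ʳ r) s j l f)) (allVecs k) ≡ binomWeighted k (#zeroCols M) (#free M) (appendedStats M s j l f)
  Σ-hasStats-append {k = k} M s j l f = trans (sumL-ext (allVecs k) (λ r → hasStats-append M r s j l f))
    (Σ-admissible-rows k k (zeroCol M) (blocked M) (zeroCol∧blocked≡false M) ℕP.≤-refl (appendedStats M s j l f))

  b2n[+≡ᵇ] : ∀ x d y → b2n (x + d ≡ᵇ y) ≡ b2n (d ≤ᵇ y) * b2n (x ≡ᵇ y ∸ d)
  b2n[+≡ᵇ] x d y = trans (cong b2n (+≡ᵇ-split x d y)) (b2n-∧ (d ≤ᵇ y) (x ≡ᵇ y ∸ d))

  binom*b2n[≡ᵇ] : ∀ x y a → binom x a * b2n (x ≡ᵇ y) ≡ binom y a * b2n (x ≡ᵇ y)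
  binom*b2n[≡ᵇ] x y a with x ≡ᵇ y in eq
  ... | true  = cong (λ t → binom t a * 1) (ℕP.≡ᵇ⇒≡ x y (subst T (sym eq) _))
  ... | false = trans (ℕP.*-zeroʳ (binom x a)) (sym (ℕP.*-zeroʳ (binom y a)))

  -- Under the indicator, #zeroCols M = l + a and #free M = f + c − [a + c > 0], so the binomials no longer depend on M.
  binomWeights-appendedStats : (M : Matrix n k) → ∀ s j l f a c →
    binom (#zeroCols M) a * (binom (#free M) c * appendedStats M s j l f a c)
      ≡ transition s j l f a c * b2n (hasStats M (s ∸ isPos a) (j ∸ isZero (a + c)) (l + a) (f + c ∸ isPos (a + c)))
  binomWeights-appendedStats M s j l f a c = begin
    binom (#zeroCols M) a * (binom (#free M) c * appendedStats M s j l f a c)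
      ≡⟨ cong (λ t → binom (#zeroCols M) a * (binom (#free M) c * t)) expand ⟩
    BZ * (BF * (g * ((L₁ * x₁) * ((L₂ * x₂) * (x₃ * (L₃ * x₄))))))
      ≡⟨ rearrange₁ BZ BF g L₁ x₁ L₂ x₂ x₃ L₃ x₄ ⟩
    (BZ * x₃) * (BF * x₄) * (g * L₁ * x₁ * L₂ * x₂ * L₃)
      ≡⟨ cong₂ (λ u v → u * v * (g * L₁ * x₁ * L₂ * x₂ * L₃)) (binom*b2n[≡ᵇ] (#zeroCols M) (l + a) a) (binom*b2n[≡ᵇ] (#free M) f′ c) ⟩
    (binom (l + a) a * x₃) * (binom f′ c * x₄) * (g * L₁ * x₁ * L₂ * x₂ * L₃)
      ≡⟨ rearrange₂ (binom (l + a) a) (binom f′ c) g L₁ x₁ L₂ x₂ x₃ L₃ x₄ ⟩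
    binom (l + a) a * binom f′ c * (L₁ * L₂ * L₃) * (g * (x₁ * (x₂ * (x₃ * x₄))))
      ≡⟨ cong (transition s j l f a c *_) (sym collapse) ⟩
    transition s j l f a c * b2n (hasStats M (s ∸ isPos a) (j ∸ isZero (a + c)) (l + a) f′) ∎
    where
      f′ = f + c ∸ isPos (a + c)
      BZ = binom (#zeroCols M) a
      BF = binom (#free M) c
      g  = b2n (noΓ M)
      L₁ = b2n (isPos a ≤ᵇ s)
      x₁ = b2n (#top M ≡ᵇ s ∸ isPos a)
      L₂ = b2n (isZero (a + c) ≤ᵇ j)
      x₂ = b2n (#zeroRows M ≡ᵇ j ∸ isZero (a + c))
      x₃ = b2n (#zeroCols M ≡ᵇ l + a)
      L₃ = b2n (isPos (a + c) ≤ᵇ f + c)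
      x₄ = b2n (#free M ≡ᵇ f′)
      expand : appendedStats M s j l f a c ≡ g * ((L₁ * x₁) * ((L₂ * x₂) * (x₃ * (L₃ * x₄))))
      expand =
        trans (b2n-∧ (noΓ M) _) (cong (g *_)
        (trans (b2n-∧ (#top M + isPos a ≡ᵇ s) _) (cong₂ _*_ (b2n[+≡ᵇ] (#top M) (isPos a) s)
        (trans (b2n-∧ (#zeroRows M + isZero (a + c) ≡ᵇ j) _) (cong₂ _*_ (b2n[+≡ᵇ] (#zeroRows M) (isZero (a + c)) j)
        (trans (b2n-∧ (#zeroCols M ≡ᵇ l + a) _) (cong (x₃ *_) (b2n[+≡ᵇ] (#free M) (isPos (a + c)) (f + c)))))))))
      collapse : b2n (hasStats M (s ∸ isPos a) (j ∸ isZero (a + c)) (l + a) f′) ≡ g * (x₁ * (x₂ * (x₃ * x₄)))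
      collapse =
        trans (b2n-∧ (noΓ M) _) (cong (g *_) (trans (b2n-∧ (#top M ≡ᵇ s ∸ isPos a) _) (cong (x₁ *_)
        (trans (b2n-∧ (#zeroRows M ≡ᵇ j ∸ isZero (a + c)) _) (cong (x₂ *_) (b2n-∧ (#zeroCols M ≡ᵇ l + a) _))))))
      rearrange₁ : ∀ BZ BF g L₁ x₁ L₂ x₂ x₃ L₃ x₄ →
        BZ * (BF * (g * ((L₁ * x₁) * ((L₂ * x₂) * (x₃ * (L₃ * x₄)))))) ≡ (BZ * x₃) * (BF * x₄) * (g * L₁ * x₁ * L₂ * x₂ * L₃)
      rearrange₁ = solve-∀
      rearrange₂ : ∀ B₁ B₂ g L₁ x₁ L₂ x₂ x₃ L₃ x₄ →
        (B₁ * x₃) * (B₂ * x₄) * (g * L₁ * x₁ * L₂ * x₂ * L₃) ≡ B₁ * B₂ * (L₁ * L₂ * L₃) * (g * (x₁ * (x₂ * (x₃ * x₄))))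
      rearrange₂ = solve-∀

  refinedCount-rec : ∀ n k s j l f → refinedCount (suc n) k s j l f ≡
    Σ< (suc k) (λ a → Σ< (suc k) (λ c →
      transition s j l f a c * refinedCount n k (s ∸ isPos a) (j ∸ isZero (a + c)) (l + a) (f + c ∸ isPos (a + c))))
  refinedCount-rec n k s j l f = begin
    sumL (λ M → b2n (hasStats M s j l f)) (allMatrices (suc n) k)
      ≡⟨ sumL-allMatrices-suc n k (λ M → b2n (hasStats M s j l f)) ⟩
    sumL (λ M → sumL (λ r → b2n (hasStats (M ∷ʳ r) s j l f)) (allVecs k)) (allMatrices n k)
      ≡⟨ sumL-ext (allMatrices n k) per-matrix ⟩
    sumL (λ M → Σ< (suc k) (λ a → Σ< (suc k) (λ c → transition s j l f a c * ind M a c))) (allMatrices n k)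
      ≡⟨ sumL-Σ< (suc k) (λ M a → Σ< (suc k) (λ c → transition s j l f a c * ind M a c)) (allMatrices n k) ⟩
    Σ< (suc k) (λ a → sumL (λ M → Σ< (suc k) (λ c → transition s j l f a c * ind M a c)) (allMatrices n k))
      ≡⟨ Σ<-ext (suc k) (λ a → trans (sumL-Σ< (suc k) (λ M c → transition s j l f a c * ind M a c) (allMatrices n k))
                                      (Σ<-ext (suc k) (λ c → sym (sumL-*ˡ (transition s j l f a c) (λ M → ind M a c) (allMatrices n k))))) ⟩
    Σ< (suc k) (λ a → Σ< (suc k) (λ c →
      transition s j l f a c * refinedCount n k (s ∸ isPos a) (j ∸ isZero (a + c)) (l + a) (f + c ∸ isPos (a + c)))) ∎
    where
      ind : Matrix n k → ℕ → ℕ → ℕ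
      ind M a c = b2n (hasStats M (s ∸ isPos a) (j ∸ isZero (a + c)) (l + a) (f + c ∸ isPos (a + c)))
      per-matrix : ∀ M → sumL (λ r → b2n (hasStats (M ∷ʳ r) s j l f)) (allVecs k)
                         ≡ Σ< (suc k) (λ a → Σ< (suc k) (λ c → transition s j l f a c * ind M a c))
      per-matrix M = trans (Σ-hasStats-append M s j l f) (Σ<-ext (suc k) (λ a →
        trans (Σ<-*ˡ (suc k) (binom (#zeroCols M) a) (λ c → binom (#free M) c * appendedStats M s j l f a c))
              (Σ<-ext (suc k) (binomWeights-appendedStats M s j l f a))))

  binom*surj-zero : ∀ k l → binom k l * surj (k ∸ l) 0 ≡ b2n (k ≡ᵇ l)
  binom*surj-zero zero    zero    = refl
  binom*surj-zero zero    (suc l) = refl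
  binom*surj-zero (suc k) zero    = refl
  binom*surj-zero (suc k) (suc l) =
    trans (ℕP.*-distribʳ-+ (isZero (k ∸ l)) (binom k l) (binom k (suc l)))
          (trans (cong₂ _+_ (binom*surj-zero k l) (below k l (suc l) ℕP.≤-refl)) (ℕP.+-identityʳ _))
    where
      below : ∀ k l m → l < m → binom k m * isZero (k ∸ l) ≡ 0
      below zero    l       (suc m) p       = refl
      below (suc k) zero    m       p       = ℕP.*-zeroʳ (binom (suc k) m)
      below (suc k) (suc l) (suc m) (s≤s p) = trans (ℕP.*-distribʳ-+ (isZero (k ∸ l)) (binom k m) (binom k (suc m)))
        (cong₂ _+_ (below k l m p) (below k l (suc m) (ℕP.m≤n⇒m≤1+n p)))

  refinedCount-empty : ∀ k s j l f → refinedCount 0 k s j l f ≡ closedForm 0 k s j l f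
  refinedCount-empty k s j l f = trans (ℕP.+-identityʳ _) (trans (cong b2n stats) (by-cases s j f))
    where
      stats : hasStats {0} {k} [] s j l f ≡ ((0 ≡ᵇ s) ∧ ((0 ≡ᵇ j) ∧ ((k ≡ᵇ l) ∧ (0 ≡ᵇ f))))
      stats = cong₂ (λ x y → (0 ≡ᵇ s) ∧ ((0 ≡ᵇ j) ∧ ((x ≡ᵇ l) ∧ (y ≡ᵇ f))))
                    (trans (cntF-ext {k} {zeroCol {0} {k} []} {λ _ → true} (λ _ → refl)) (cntF-const {k}))
                    (trans (cntF-ext {k} {λ j → not (zeroCol {0} {k} [] j) ∧ not (blocked {0} {k} [] j)} {λ _ → false} (λ _ → refl)) (cntF-false {k}))
      by-cases : ∀ s j f → b2n ((0 ≡ᵇ s) ∧ ((0 ≡ᵇ j) ∧ ((k ≡ᵇ l) ∧ (0 ≡ᵇ f)))) ≡ closedForm 0 k s j l f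
      by-cases zero    (suc j) f       = refl
      by-cases (suc s) (suc j) f       = refl
      by-cases (suc s) zero    f       = refl
      by-cases zero    zero    (suc f) =
        trans (cong b2n (BP.∧-zeroʳ (k ≡ᵇ l))) (sym (ℕP.*-zeroʳ (1 * 1 * (binom k l * isZero (k ∸ l)))))
      by-cases zero    zero    zero    =
        trans (cong b2n (BP.∧-identityʳ (k ≡ᵇ l))) (sym (trans (ℕP.*-identityʳ _) (trans (ℕP.*-identityˡ _) (binom*surj-zero k l))))

  refinedCount≡closedForm : ∀ n k s j l f → refinedCount n k s j l f ≡ closedForm n k s j l f
  refinedCount≡closedForm zero    k s j l f = refinedCount-empty k s j l f
  refinedCount≡closedForm (suc n) k s j l f = begin
    refinedCount (suc n) k s j l f
      ≡⟨ refinedCount-rec n k s j l f ⟩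
    Σ< (suc k) (λ a → Σ< (suc k) (λ c →
      transition s j l f a c * refinedCount n k (s ∸ isPos a) (j ∸ isZero (a + c)) (l + a) (f + c ∸ isPos (a + c))))
      ≡⟨ Σ<-ext (suc k) (λ a → Σ<-ext (suc k) (λ c → cong (transition s j l f a c *_)
           (refinedCount≡closedForm n k (s ∸ isPos a) (j ∸ isZero (a + c)) (l + a) (f + c ∸ isPos (a + c))))) ⟩
    Σ< (suc k) (λ a → Σ< (suc k) (step n k s j l f a))
      ≡⟨ closedForm-rec n k s j l f ⟩
    closedForm (suc n) k s j l f ∎

  Σ-b2n[≡ᵇ] : ∀ x N → x < N → Σ< N (λ f → b2n (x ≡ᵇ f)) ≡ 1
  Σ-b2n[≡ᵇ] x N x<N =
    trans (Σ<-single N x (λ f → b2n (x ≡ᵇ f)) x<N (λ f f≢x → cong b2n (≢⇒≡ᵇ-false (λ x≡f → f≢x (sym x≡f)))))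
          (cong b2n (≡ᵇ-refl x))

  countG-by-free : (M : Matrix n k) → ∀ i j l →
    b2n (noΓ M ∧ (#top M ≡ᵇ i) ∧ (#zeroRows M ≡ᵇ j) ∧ (#zeroCols M ≡ᵇ l)) ≡ Σ< (suc k) (λ f → b2n (hasStats M i j l f))
  countG-by-free {k = k} M i j l = begin
    b2n P
      ≡⟨ sym (ℕP.*-identityʳ _) ⟩
    b2n P * 1
      ≡⟨ cong (b2n P *_) (sym (Σ-b2n[≡ᵇ] (#free M) (suc k) (s≤s (cntF-≤ _)))) ⟩
    b2n P * Σ< (suc k) (λ f → b2n (#free M ≡ᵇ f))
      ≡⟨ Σ<-*ˡ (suc k) (b2n P) (λ f → b2n (#free M ≡ᵇ f)) ⟩
    Σ< (suc k) (λ f → b2n P * b2n (#free M ≡ᵇ f))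
      ≡⟨ Σ<-ext (suc k) (λ f → sym (b2n-∧⁴ (noΓ M) (#top M ≡ᵇ i) (#zeroRows M ≡ᵇ j) (#zeroCols M ≡ᵇ l) (#free M ≡ᵇ f))) ⟩
    Σ< (suc k) (λ f → b2n (hasStats M i j l f)) ∎
    where
      P = noΓ M ∧ (#top M ≡ᵇ i) ∧ (#zeroRows M ≡ᵇ j) ∧ (#zeroCols M ≡ᵇ l)
      b2n-∧⁴ : ∀ a b c d e → b2n (a ∧ (b ∧ (c ∧ (d ∧ e)))) ≡ b2n (a ∧ (b ∧ (c ∧ d))) * b2n e
      b2n-∧⁴ a b c d true  rewrite BP.∧-identityʳ d = sym (ℕP.*-identityʳ (b2n (a ∧ (b ∧ (c ∧ d)))))
      b2n-∧⁴ a b c d false rewrite BP.∧-zeroʳ d | BP.∧-zeroʳ c | BP.∧-zeroʳ b | BP.∧-zeroʳ a =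
        sym (ℕP.*-zeroʳ (b2n (a ∧ (b ∧ (c ∧ d)))))

  countG≡countFormula : ∀ i j l n k → countG i j l n k ≡ countFormula i j l n k
  countG≡countFormula i j l n k = begin
    countG i j l n k
      ≡⟨ length-filter (λ m → Γ-free m ∧ (rₜ m ≡ᵇ i) ∧ (rₑ m ≡ᵇ j) ∧ (cₑ m ≡ᵇ l)) (allMatrices n k) ⟩
    sumL (λ m → b2n (Γ-free m ∧ (rₜ m ≡ᵇ i) ∧ (rₑ m ≡ᵇ j) ∧ (cₑ m ≡ᵇ l))) (allMatrices n k)
      ≡⟨ sumL-ext (allMatrices n k) (λ m → trans (cong b2n (statistics m)) (countG-by-free m i j l)) ⟩
    sumL (λ m → Σ< (suc k) (λ f → b2n (hasStats m i j l f))) (allMatrices n k)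
      ≡⟨ sumL-Σ< (suc k) (λ m f → b2n (hasStats m i j l f)) (allMatrices n k) ⟩
    Σ< (suc k) (λ f → refinedCount n k i j l f)
      ≡⟨ Σ<-ext (suc k) (refinedCount≡closedForm n k i j l) ⟩
    Σ< (suc k) (closedForm n k i j l)
      ≡⟨ Σ-closedForm n k i j l ⟩
    countFormula i j l n k ∎
    where
      statistics : (m : Matrix n k) → (Γ-free m ∧ (rₜ m ≡ᵇ i) ∧ (rₑ m ≡ᵇ j) ∧ (cₑ m ≡ᵇ l))
                                     ≡ (noΓ m ∧ (#top m ≡ᵇ i) ∧ (#zeroRows m ≡ᵇ j) ∧ (#zeroCols m ≡ᵇ l))
      statistics m = cong₂ _∧_ (Γ-free≡noΓ m)
                       (cong₂ _∧_ (cong (_≡ᵇ i) (rₜ≡#top m)) (cong₂ _∧_ (cong (_≡ᵇ j) (rₑ≡#zeroRows m)) (cong (_≡ᵇ l) (cₑ≡#zeroCols m))))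


module RationalEmbedding where

  open import Data.Nat as ℕ using (ℕ; suc; _!; pred; _≤_)
  import Data.Nat.Properties as ℕP
  open import Data.Integer as ℤ using (+_)
  import Data.Integer.Properties as ℤP
  open import Data.Rational as ℚ using (ℚ; 1ℚ; _+_; _*_; fromℚᵘ)
  open import Data.Rational.Properties
  import Data.Rational.Unnormalised as ℚᵘ
  import Data.Rational.Unnormalised.Properties as ℚᵘP
  open import Data.Rational.Solver using (module +-*-Solver)
  open +-*-Solver
  open import Relation.Binary.PropositionalEquality
  open ≡-Reasoning
  open Sums

  ι : ℕ → ℚ
  ι n = ℚ._/_ (+ n) 1

  fromℚᵘ-+ : ∀ p q → fromℚᵘ (p ℚᵘ.+ q) ≡ fromℚᵘ p + fromℚᵘ q
  fromℚᵘ-+ p q = toℚᵘ-injective (ℚᵘP.≃-trans (toℚᵘ-fromℚᵘ (p ℚᵘ.+ q))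
    (ℚᵘP.≃-sym (ℚᵘP.≃-trans (toℚᵘ-homo-+ (fromℚᵘ p) (fromℚᵘ q)) (ℚᵘP.+-cong (toℚᵘ-fromℚᵘ p) (toℚᵘ-fromℚᵘ q)))))

  fromℚᵘ-* : ∀ p q → fromℚᵘ (p ℚᵘ.* q) ≡ fromℚᵘ p * fromℚᵘ q
  fromℚᵘ-* p q = toℚᵘ-injective (ℚᵘP.≃-trans (toℚᵘ-fromℚᵘ (p ℚᵘ.* q))
    (ℚᵘP.≃-sym (ℚᵘP.≃-trans (toℚᵘ-homo-* (fromℚᵘ p) (fromℚᵘ q)) (ℚᵘP.*-cong (toℚᵘ-fromℚᵘ p) (toℚᵘ-fromℚᵘ q)))))

  ι-+ : ∀ a b → ι (a ℕ.+ b) ≡ ι a + ι b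
  ι-+ a b = trans (fromℚᵘ-cong {ℚᵘ.mkℚᵘ (+ (a ℕ.+ b)) 0} {ℚᵘ.mkℚᵘ (+ a) 0 ℚᵘ.+ ℚᵘ.mkℚᵘ (+ b) 0} (ℚᵘ.*≡* eq))
                  (fromℚᵘ-+ (ℚᵘ.mkℚᵘ (+ a) 0) (ℚᵘ.mkℚᵘ (+ b) 0))
    where
      eq : + (a ℕ.+ b) ℤ.* + 1 ≡ (+ a ℤ.* + 1 ℤ.+ + b ℤ.* + 1) ℤ.* + 1
      eq rewrite ℤP.*-identityʳ (+ a) | ℤP.*-identityʳ (+ b) | ℤP.*-identityʳ (+ (a ℕ.+ b)) = refl

  ι-* : ∀ a b → ι (a ℕ.* b) ≡ ι a * ι b
  ι-* a b = trans (fromℚᵘ-cong {ℚᵘ.mkℚᵘ (+ (a ℕ.* b)) 0} {ℚᵘ.mkℚᵘ (+ a) 0 ℚᵘ.* ℚᵘ.mkℚᵘ (+ b) 0} (ℚᵘ.*≡* eq))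
                  (fromℚᵘ-* (ℚᵘ.mkℚᵘ (+ a) 0) (ℚᵘ.mkℚᵘ (+ b) 0))
    where
      eq : + (a ℕ.* b) ℤ.* + 1 ≡ (+ a ℤ.* + b) ℤ.* + 1
      eq = cong (ℤ._* + 1) (ℤP.pos-* a b)

  inv!*ι! : ∀ n → inv! n * ι (n !) ≡ 1ℚ
  inv!*ι! n = begin
    inv! n * ι (n !)
      ≡⟨ cong (_* ι (n !)) (/≡fromℚᵘ (+ 1) (n !) {{n ℕP.!≢0}}) ⟩
    fromℚᵘ (ℚᵘ.mkℚᵘ (+ 1) (pred (n !))) * fromℚᵘ (ℚᵘ.mkℚᵘ (+ (n !)) 0)
      ≡⟨ sym (fromℚᵘ-* (ℚᵘ.mkℚᵘ (+ 1) (pred (n !))) (ℚᵘ.mkℚᵘ (+ (n !)) 0)) ⟩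
    fromℚᵘ (ℚᵘ.mkℚᵘ (+ 1) (pred (n !)) ℚᵘ.* ℚᵘ.mkℚᵘ (+ (n !)) 0)
      ≡⟨ fromℚᵘ-cong {ℚᵘ.mkℚᵘ (+ 1) (pred (n !)) ℚᵘ.* ℚᵘ.mkℚᵘ (+ (n !)) 0} {ℚᵘ.mkℚᵘ (+ 1) 0} (ℚᵘ.*≡* eq) ⟩
    1ℚ ∎
    where
      /≡fromℚᵘ : ∀ i d .{{_ : ℕ.NonZero d}} → ℚ._/_ i d ≡ fromℚᵘ (ℚᵘ.mkℚᵘ i (pred d))
      /≡fromℚᵘ i (suc d) = refl
      eq : (+ 1 ℤ.* + (n !)) ℤ.* + 1 ≡ + 1 ℤ.* + (suc (pred (n !)) ℕ.* 1)
      eq = trans (ℤP.*-identityʳ (+ 1 ℤ.* + (n !)))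
                 (trans (ℤP.*-identityˡ (+ (n !)))
                        (sym (trans (ℤP.*-identityˡ _) (cong +_ (trans (ℕP.*-identityʳ _) (ℕP.suc-pred (n !) {{n ℕP.!≢0}}))))))

  inv!*inv! : ∀ a b → inv! a * inv! b ≡ ι (binom (a ℕ.+ b) a) * inv! (a ℕ.+ b)
  inv!*inv! a b = begin
    A * B                                     ≡⟨ sym (*-identityʳ (A * B)) ⟩
    A * B * 1ℚ                                ≡⟨ cong (λ z → A * B * z) (sym (inv!*ι! (a ℕ.+ b))) ⟩
    A * B * (C * ι ((a ℕ.+ b) !))             ≡⟨ cong (λ z → A * B * (C * ι z)) (sym (binom-factorials a b)) ⟩
    A * B * (C * ι (binom (a ℕ.+ b) a ℕ.* (a ! ℕ.* b !)))
      ≡⟨ cong (λ z → A * B * (C * z)) (trans (ι-* (binom (a ℕ.+ b) a) (a ! ℕ.* b !)) (cong (K *_) (ι-* (a !) (b !)))) ⟩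
    A * B * (C * (K * (ι (a !) * ι (b !))))
      ≡⟨ solve 6 (λ A B C K X Y → A :* B :* (C :* (K :* (X :* Y))) := (A :* X) :* (B :* Y) :* (K :* C)) refl A B C K (ι (a !)) (ι (b !)) ⟩
    (A * ι (a !)) * (B * ι (b !)) * (K * C)   ≡⟨ cong₂ (λ x y → x * y * (K * C)) (inv!*ι! a) (inv!*ι! b) ⟩
    1ℚ * 1ℚ * (K * C)                         ≡⟨ *-identityˡ (K * C) ⟩
    K * C ∎
    where
      A = inv! a
      B = inv! b
      C = inv! (a ℕ.+ b)
      K = ι (binom (a ℕ.+ b) a)

  inv!*inv!-∸ : ∀ {a n} → a ≤ n → inv! a * inv! (n ℕ.∸ a) ≡ ι (binom n a) * inv! n
  inv!*inv!-∸ {a} {n} a≤n = trans (inv!*inv! a (n ℕ.∸ a)) (cong (λ N → ι (binom N a) * inv! N) (ℕP.m+[n∸m]≡n a≤n))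

module RationalSums where

  open import Data.Nat as ℕ using (ℕ; zero; suc; _≤_; _<_; s≤s)
  import Data.Nat.Properties as ℕP
  open import Data.Rational using (ℚ; 0ℚ; _+_; _*_)
  open import Data.Rational.Properties
  open import Data.List using (applyUpTo; foldr)
  open import Relation.Binary.PropositionalEquality
  open Sums
  open RationalEmbedding using (ι; ι-+)

  ΣQ : ℕ → (ℕ → ℚ) → ℚ
  ΣQ zero    f = 0ℚ
  ΣQ (suc n) f = f 0 + ΣQ n (λ i → f (suc i))

  Σ≤≡ΣQ : ∀ N f → Σ≤ N f ≡ ΣQ (suc N) f
  Σ≤≡ΣQ N f = foldr-applyUpTo (suc N) (λ i → i)
    where
      foldr-applyUpTo : ∀ n (g : ℕ → ℕ) → foldr (λ s acc → f s + acc) 0ℚ (applyUpTo g n) ≡ ΣQ n (λ i → f (g i))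
      foldr-applyUpTo zero    g = refl
      foldr-applyUpTo (suc n) g = cong (f (g 0) +_) (foldr-applyUpTo n (λ i → g (suc i)))

  ΣQ-cong : ∀ n {f g : ℕ → ℚ} → (∀ i → i < n → f i ≡ g i) → ΣQ n f ≡ ΣQ n g
  ΣQ-cong zero    h = refl
  ΣQ-cong (suc n) h = cong₂ _+_ (h 0 ℕ.z<s) (ΣQ-cong n (λ i p → h (suc i) (s≤s p)))

  ΣQ-zero : ∀ n {f : ℕ → ℚ} → (∀ i → i < n → f i ≡ 0ℚ) → ΣQ n f ≡ 0ℚ
  ΣQ-zero zero    h = refl
  ΣQ-zero (suc n) h = trans (cong₂ _+_ (h 0 ℕ.z<s) (ΣQ-zero n (λ i p → h (suc i) (s≤s p)))) (+-identityˡ 0ℚ)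

  ΣQ-single : ∀ n e (f : ℕ → ℚ) → e < n → (∀ i → i < n → i ≢ e → f i ≡ 0ℚ) → ΣQ n f ≡ f e
  ΣQ-single (suc n) zero    f p h =
    trans (cong (f 0 +_) (ΣQ-zero n (λ i q → h (suc i) (s≤s q) (λ ())))) (+-identityʳ _)
  ΣQ-single (suc n) (suc e) f (s≤s p) h =
    trans (cong (_+ ΣQ n (λ i → f (suc i))) (h 0 ℕ.z<s (λ ())))
          (trans (+-identityˡ _) (ΣQ-single n e (λ i → f (suc i)) p (λ i q r → h (suc i) (s≤s q) (λ t → r (ℕP.suc-injective t)))))

  ΣQ-*ˡ : ∀ n c (f : ℕ → ℚ) → c * ΣQ n f ≡ ΣQ n (λ i → c * f i)
  ΣQ-*ˡ zero    c f = *-zeroʳ c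
  ΣQ-*ˡ (suc n) c f = trans (*-distribˡ-+ c (f 0) _) (cong (c * f 0 +_) (ΣQ-*ˡ n c _))

  ι-Σ< : ∀ n (f : ℕ → ℕ) → ι (Σ< n f) ≡ ΣQ n (λ i → ι (f i))
  ι-Σ< zero    f = refl
  ι-Σ< (suc n) f = trans (ι-+ (f 0) (Σ< n (λ i → f (suc i)))) (cong (ι (f 0) +_) (ι-Σ< n (λ i → f (suc i))))

  Σ≤-cong : ∀ N {f g : ℕ → ℚ} → (∀ i → i ≤ N → f i ≡ g i) → Σ≤ N f ≡ Σ≤ N g
  Σ≤-cong N {f} {g} h = trans (Σ≤≡ΣQ N f) (trans (ΣQ-cong (suc N) (λ i p → h i (ℕP.≤-pred p))) (sym (Σ≤≡ΣQ N g)))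

  Σ≤-zero : ∀ N {f : ℕ → ℚ} → (∀ i → i ≤ N → f i ≡ 0ℚ) → Σ≤ N f ≡ 0ℚ
  Σ≤-zero N {f} h = trans (Σ≤≡ΣQ N f) (ΣQ-zero (suc N) (λ i p → h i (ℕP.≤-pred p)))

  Σ≤-single : ∀ N e (f : ℕ → ℚ) → e ≤ N → (∀ i → i ≤ N → i ≢ e → f i ≡ 0ℚ) → Σ≤ N f ≡ f e
  Σ≤-single N e f p h = trans (Σ≤≡ΣQ N f) (ΣQ-single (suc N) e f (s≤s p) (λ i q → h i (ℕP.≤-pred q)))

  Σ≤-*ˡ : ∀ N c (f : ℕ → ℚ) → c * Σ≤ N f ≡ Σ≤ N (λ i → c * f i)
  Σ≤-*ˡ N c f = trans (cong (c *_) (Σ≤≡ΣQ N f)) (trans (ΣQ-*ˡ (suc N) c f) (sym (Σ≤≡ΣQ N (λ i → c * f i))))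

  Σ≤-*ʳ : ∀ N c (f : ℕ → ℚ) → Σ≤ N f * c ≡ Σ≤ N (λ i → f i * c)
  Σ≤-*ʳ N c f = trans (*-comm (Σ≤ N f) c) (trans (Σ≤-*ˡ N c f) (Σ≤-cong N (λ i _ → *-comm c (f i))))


module CauchyProduct where

  open import Data.Nat as ℕ using (ℕ; _≤_; _∸_)
  open import Data.Rational using (ℚ; 0ℚ; _*_)
  open import Relation.Binary.PropositionalEquality
  open RationalSums

  infix 4 _≐_
  _≐_ : PS → PS → Set
  f ≐ g = ∀ i j l p q → f i j l p q ≡ g i j l p q

  ≐-trans : ∀ {f g h} → f ≐ g → g ≐ h → f ≐ h
  ≐-trans fg gh i j l p q = trans (fg i j l p q) (gh i j l p q)

  ⊛-cong : ∀ {f f′ g g′} → f ≐ f′ → g ≐ g′ → (f ⊛ g) ≐ (f′ ⊛ g′)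
  ⊛-cong ef eg i j l p q =
    Σ≤-cong i (λ a _ → Σ≤-cong j (λ b _ → Σ≤-cong l (λ c _ → Σ≤-cong p (λ d _ → Σ≤-cong q (λ e _ →
      cong₂ _*_ (ef a b c d e) (eg (i ∸ a) (j ∸ b) (l ∸ c) (p ∸ d) (q ∸ e)))))))

  Σ≤²-zero : ∀ N M (h : ℕ → ℕ → ℚ) → (∀ a b → a ≤ N → b ≤ M → h a b ≡ 0ℚ) → Σ≤ N (λ a → Σ≤ M (h a)) ≡ 0ℚ
  Σ≤²-zero N M h z = Σ≤-zero N (λ a a≤N → Σ≤-zero M (λ b b≤M → z a b a≤N b≤M))

  module _ (f g : PS) (i j l p q : ℕ) where

    summand : ℕ → ℕ → ℕ → ℕ → ℕ → ℚ
    summand a b c d e = f a b c d e * g (i ∸ a) (j ∸ b) (l ∸ c) (p ∸ d) (q ∸ e)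

    ⊛-vanishes : (∀ a b c d e → a ≤ i → b ≤ j → c ≤ l → d ≤ p → e ≤ q → summand a b c d e ≡ 0ℚ) →
      (f ⊛ g) i j l p q ≡ 0ℚ
    ⊛-vanishes z = Σ≤-zero i (λ a a≤i → Σ≤-zero j (λ b b≤j → Σ≤-zero l (λ c c≤l →
      Σ≤²-zero p q (summand a b c) (λ d e → z a b c d e a≤i b≤j c≤l))))

    ⊛-collapse : ∀ a₀ b₀ c₀ → a₀ ≤ i → b₀ ≤ j → c₀ ≤ l →
      (∀ a → a ≤ i → a ≢ a₀ → ∀ b c d e → summand a b c d e ≡ 0ℚ) →
      (∀ b → b ≤ j → b ≢ b₀ → ∀ c d e → summand a₀ b c d e ≡ 0ℚ) →
      (∀ c → c ≤ l → c ≢ c₀ → ∀ d e → summand a₀ b₀ c d e ≡ 0ℚ) →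
      (f ⊛ g) i j l p q ≡ Σ≤ p (λ d → Σ≤ q (summand a₀ b₀ c₀ d))
    ⊛-collapse a₀ b₀ c₀ a₀≤i b₀≤j c₀≤l off-a off-b off-c =
      trans (Σ≤-single i a₀ _ a₀≤i (λ a a≤i a≢a₀ → Σ≤-zero j (λ b _ → Σ≤-zero l (λ c _ →
                Σ≤²-zero p q (summand a b c) (λ d e _ _ → off-a a a≤i a≢a₀ b c d e)))))
     (trans (Σ≤-single j b₀ _ b₀≤j (λ b b≤j b≢b₀ → Σ≤-zero l (λ c _ →
                Σ≤²-zero p q (summand a₀ b c) (λ d e _ _ → off-b b b≤j b≢b₀ c d e))))
            (Σ≤-single l c₀ _ c₀≤l (λ c c≤l c≢c₀ → Σ≤²-zero p q (summand a₀ b₀ c) (λ d e _ _ → off-c c c≤l c≢c₀ d e))))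


module Concentrated where

  open import Data.Nat as ℕ using (ℕ; zero; suc; _≤_; _∸_; _≡ᵇ_; _≤?_)
  import Data.Nat.Properties as ℕP
  open import Data.Bool using (true; false; if_then_else_)
  open import Data.Rational using (ℚ; 0ℚ; _*_)
  open import Data.Rational.Properties using (*-zeroˡ; *-zeroʳ)
  open import Relation.Binary.PropositionalEquality
  open import Relation.Nullary using (yes; no)
  open import Data.Empty using (⊥-elim)
  open ≡-Reasoning
  open Sums using (≡ᵇ-refl; ≢⇒≡ᵇ-false; +-cancelˡ-≡ᵇ)
  open RationalSums
  open CauchyProduct

  XY : Set
  XY = ℕ → ℕ → ℚ

  _⋆_ : XY → XY → XY
  (h ⋆ h′) p q = Σ≤ p (λ d → Σ≤ q (λ e → h d e * h′ (p ∸ d) (q ∸ e)))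

  infix 8 t^_·_
  t^_·_ : ℕ → XY → PS
  (t^ i₀ · h) i zero zero p q = if i ≡ᵇ i₀ then h p q else 0ℚ
  (t^ i₀ · h) i _    _    p q = 0ℚ

  t^·-off : ∀ i₀ h i j l p q → i ≢ i₀ → (t^ i₀ · h) i j l p q ≡ 0ℚ
  t^·-off i₀ h i zero    zero    p q i≢i₀ rewrite ≢⇒≡ᵇ-false i≢i₀ = refl
  t^·-off i₀ h i zero    (suc l) p q i≢i₀ = refl
  t^·-off i₀ h i (suc j) l       p q i≢i₀ = refl

  t^·-on : ∀ i₀ h p q → (t^ i₀ · h) i₀ 0 0 p q ≡ h p q
  t^·-on i₀ h p q rewrite ≡ᵇ-refl i₀ = refl

  t^·-cong : ∀ i₀ {h h′ : XY} → (∀ p q → h p q ≡ h′ p q) → (t^ i₀ · h) ≐ (t^ i₀ · h′)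
  t^·-cong i₀ eq i zero    zero    p q = cong (if i ≡ᵇ i₀ then_else 0ℚ) (eq p q)
  t^·-cong i₀ eq i zero    (suc l) p q = refl
  t^·-cong i₀ eq i (suc j) l       p q = refl

  t^·-⊛ : ∀ i₀ i₁ h h′ → ((t^ i₀ · h) ⊛ (t^ i₁ · h′)) ≐ (t^ (i₀ ℕ.+ i₁) · (h ⋆ h′))
  t^·-⊛ i₀ i₁ h h′ i j l p q with i₀ ≤? i
  ... | no i₀≰i = trans
    (⊛-vanishes (t^ i₀ · h) (t^ i₁ · h′) i j l p q (λ a b c d e a≤i _ _ _ _ →
      trans (cong (_* (t^ i₁ · h′) (i ∸ a) (j ∸ b) (l ∸ c) (p ∸ d) (q ∸ e)) (t^·-off i₀ h a b c d e (λ a≡i₀ → i₀≰i (subst (_≤ i) a≡i₀ a≤i))))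
            (*-zeroˡ ((t^ i₁ · h′) (i ∸ a) (j ∸ b) (l ∸ c) (p ∸ d) (q ∸ e)))))
    (sym (t^·-off (i₀ ℕ.+ i₁) (h ⋆ h′) i j l p q (λ i≡ → i₀≰i (subst (i₀ ≤_) (sym i≡) (ℕP.m≤m+n i₀ i₁)))))
  ... | yes i₀≤i = begin
    ((t^ i₀ · h) ⊛ (t^ i₁ · h′)) i j l p q
      ≡⟨ ⊛-collapse (t^ i₀ · h) (t^ i₁ · h′) i j l p q i₀ 0 0 i₀≤i ℕ.z≤n ℕ.z≤n
           (λ a _ a≢i₀ b c d e → trans (cong (_* rest a b c d e) (t^·-off i₀ h a b c d e a≢i₀)) (*-zeroˡ (rest a b c d e)))
           (λ { zero _ 0≢0 → ⊥-elim (0≢0 refl) ; (suc b) _ _ c d e → *-zeroˡ (rest i₀ (suc b) c d e) })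
           (λ { zero _ 0≢0 → ⊥-elim (0≢0 refl) ; (suc c) _ _ d e → *-zeroˡ (rest i₀ 0 (suc c) d e) }) ⟩
    Σ≤ p (λ d → Σ≤ q (λ e → (t^ i₀ · h) i₀ 0 0 d e * rest i₀ 0 0 d e))
      ≡⟨ Σ≤-cong p (λ d _ → Σ≤-cong q (λ e _ → cong (_* rest i₀ 0 0 d e) (t^·-on i₀ h d e))) ⟩
    Σ≤ p (λ d → Σ≤ q (λ e → h d e * (t^ i₁ · h′) (i ∸ i₀) j l (p ∸ d) (q ∸ e)))
      ≡⟨ by-degrees j l ⟩
    (t^ (i₀ ℕ.+ i₁) · (h ⋆ h′)) i j l p q ∎
    where
      rest : ℕ → ℕ → ℕ → ℕ → ℕ → ℚ
      rest a b c d e = (t^ i₁ · h′) (i ∸ a) (j ∸ b) (l ∸ c) (p ∸ d) (q ∸ e)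
      degree : (i ∸ i₀ ≡ᵇ i₁) ≡ (i ≡ᵇ i₀ ℕ.+ i₁)
      degree = trans (sym (+-cancelˡ-≡ᵇ i₀ (i ∸ i₀) i₁)) (cong (_≡ᵇ i₀ ℕ.+ i₁) (ℕP.m+[n∸m]≡n i₀≤i))
      by-degrees : ∀ j l → Σ≤ p (λ d → Σ≤ q (λ e → h d e * (t^ i₁ · h′) (i ∸ i₀) j l (p ∸ d) (q ∸ e)))
                         ≡ (t^ (i₀ ℕ.+ i₁) · (h ⋆ h′)) i j l p q
      by-degrees zero zero rewrite degree with i ≡ᵇ i₀ ℕ.+ i₁
      ... | true  = refl
      ... | false = Σ≤²-zero p q _ (λ d e _ _ → *-zeroʳ (h d e))
      by-degrees zero    (suc l) = Σ≤²-zero p q _ (λ d e _ _ → *-zeroʳ (h d e))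
      by-degrees (suc j) l       = Σ≤²-zero p q _ (λ d e _ _ → *-zeroʳ (h d e))


module RHSCoefficients where

  open import Data.Nat as ℕ using (ℕ; zero; suc; _≤_; _<_; _∸_; _≡ᵇ_; _≤?_; z≤n)
  import Data.Nat.Properties as ℕP
  open import Data.Bool using (if_then_else_)
  open import Data.Rational using (ℚ; 0ℚ; 1ℚ; _+_; _*_; _-_)
  open import Data.Rational.Properties using (*-zeroˡ; *-zeroʳ; *-identityˡ; *-identityʳ; *-assoc; +-identityˡ; +-identityʳ)
  open import Data.Rational.Solver using (module +-*-Solver)
  open +-*-Solver
  open import Data.Empty using (⊥-elim)
  open import Relation.Binary.PropositionalEquality
  open import Relation.Nullary using (yes; no)
  open ≡-Reasoning
  open Sums using (binom; binom-above; ≡ᵇ-refl; ≢⇒≡ᵇ-false)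
  open Stirling using (surj)
  open ClosedForm using (countFormula)
  open RationalEmbedding
  open RationalSums
  open CauchyProduct
  open Concentrated

  infixl 7 _∗_
  _∗_ : (ℕ → ℚ) → (ℕ → ℚ) → ℕ → ℚ
  (u ∗ v) p = Σ≤ p (λ d → u d * v (p ∸ d))

  infix 8 _⊗_
  _⊗_ : (ℕ → ℚ) → (ℕ → ℚ) → XY
  (u ⊗ v) p q = u p * v q

  ⊗-⋆-⊗ : ∀ u v u′ v′ p q → ((u ⊗ v) ⋆ (u′ ⊗ v′)) p q ≡ ((u ∗ u′) ⊗ (v ∗ v′)) p q
  ⊗-⋆-⊗ u v u′ v′ p q = begin
    Σ≤ p (λ d → Σ≤ q (λ e → (u d * v e) * (u′ (p ∸ d) * v′ (q ∸ e))))
      ≡⟨ Σ≤-cong p (λ d _ → Σ≤-cong q (λ e _ → interchange (u d) (v e) (u′ (p ∸ d)) (v′ (q ∸ e)))) ⟩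
    Σ≤ p (λ d → Σ≤ q (λ e → (u d * u′ (p ∸ d)) * (v e * v′ (q ∸ e))))
      ≡⟨ Σ≤-cong p (λ d _ → sym (Σ≤-*ˡ q (u d * u′ (p ∸ d)) (λ e → v e * v′ (q ∸ e)))) ⟩
    Σ≤ p (λ d → (u d * u′ (p ∸ d)) * (v ∗ v′) q)
      ≡⟨ sym (Σ≤-*ʳ p ((v ∗ v′) q) (λ d → u d * u′ (p ∸ d))) ⟩
    (u ∗ u′) p * (v ∗ v′) q ∎
    where
      interchange : ∀ a b c d → (a * b) * (c * d) ≡ (a * c) * (b * d)
      interchange = solve 4 (λ a b c d → (a :* b) :* (c :* d) := (a :* c) :* (b :* d)) refl

  δ : ℕ → ℚ
  δ zero    = 1ℚ
  δ (suc _) = 0ℚ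

  δ-∗ : ∀ u p → (δ ∗ u) p ≡ u p
  δ-∗ u p = trans (Σ≤-single p 0 (λ d → δ d * u (p ∸ d)) z≤n off) (*-identityˡ (u p))
    where
      off : ∀ d → d ≤ p → d ≢ 0 → δ d * u (p ∸ d) ≡ 0ℚ
      off zero    _ 0≢0 = ⊥-elim (0≢0 refl)
      off (suc d) _ _   = *-zeroˡ (u (p ∸ suc d))

  ∗-δ : ∀ u p → (u ∗ δ) p ≡ u p
  ∗-δ u p = trans (Σ≤-single p p (λ d → u d * δ (p ∸ d)) ℕP.≤-refl off)
                  (trans (cong (λ x → u p * δ x) (ℕP.n∸n≡0 p)) (*-identityʳ (u p)))
    where
      off : ∀ d → d ≤ p → d ≢ p → u d * δ (p ∸ d) ≡ 0ℚ
      off d d≤p d≢p with p ∸ d in eq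
      ... | zero  = ⊥-elim (d≢p (ℕP.≤-antisym d≤p (ℕP.m∸n≡0⇒m≤n eq)))
      ... | suc _ = *-zeroʳ (u d)

  expm1 : ℕ → ℚ
  expm1 zero    = 0ℚ
  expm1 (suc p) = inv! (suc p)

  -- The x^p coefficient of (e^x − 1)^s.
  egf-surj : ℕ → ℕ → ℚ
  egf-surj s p = inv! p * ι (surj p s)

  egf-surj-zero : ∀ p → egf-surj 0 p ≡ δ p
  egf-surj-zero zero    = refl
  egf-surj-zero (suc p) = *-zeroʳ (inv! (suc p))

  expm1-∗-egf-surj : ∀ s p → (expm1 ∗ egf-surj s) p ≡ egf-surj (suc s) p
  expm1-∗-egf-surj s p = begin
    Σ≤ p (λ d → expm1 d * egf-surj s (p ∸ d))
      ≡⟨ Σ≤≡ΣQ p (λ d → expm1 d * egf-surj s (p ∸ d)) ⟩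
    expm1 0 * egf-surj s p + ΣQ p (λ a → inv! (suc a) * egf-surj s (p ∸ suc a))
      ≡⟨ cong₂ _+_ (*-zeroˡ (egf-surj s p)) (ΣQ-cong p term) ⟩
    0ℚ + ΣQ p (λ a → inv! p * ι (binom p (suc a) ℕ.* surj (p ∸ suc a) s))
      ≡⟨ +-identityˡ _ ⟩
    ΣQ p (λ a → inv! p * ι (binom p (suc a) ℕ.* surj (p ∸ suc a) s))
      ≡⟨ sym (ΣQ-*ˡ p (inv! p) (λ a → ι (binom p (suc a) ℕ.* surj (p ∸ suc a) s))) ⟩
    inv! p * ΣQ p (λ a → ι (binom p (suc a) ℕ.* surj (p ∸ suc a) s))
      ≡⟨ cong (inv! p *_) (sym (ι-Σ< p (λ a → binom p (suc a) ℕ.* surj (p ∸ suc a) s))) ⟩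
    inv! p * ι (surj p (suc s)) ∎
    where
      term : ∀ a → a < p → inv! (suc a) * egf-surj s (p ∸ suc a) ≡ inv! p * ι (binom p (suc a) ℕ.* surj (p ∸ suc a) s)
      term a a<p = begin
        inv! (suc a) * (inv! (p ∸ suc a) * ι (surj (p ∸ suc a) s))
          ≡⟨ sym (*-assoc (inv! (suc a)) (inv! (p ∸ suc a)) (ι (surj (p ∸ suc a) s))) ⟩
        inv! (suc a) * inv! (p ∸ suc a) * ι (surj (p ∸ suc a) s)
          ≡⟨ cong (_* ι (surj (p ∸ suc a) s)) (inv!*inv!-∸ a<p) ⟩
        ι (binom p (suc a)) * inv! p * ι (surj (p ∸ suc a) s)
          ≡⟨ solve 3 (λ x y z → x :* y :* z := y :* (x :* z)) refl (ι (binom p (suc a))) (inv! p) (ι (surj (p ∸ suc a) s)) ⟩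
        inv! p * (ι (binom p (suc a)) * ι (surj (p ∸ suc a) s))
          ≡⟨ cong (inv! p *_) (sym (ι-* (binom p (suc a)) (surj (p ∸ suc a) s))) ⟩
        inv! p * ι (binom p (suc a) ℕ.* surj (p ∸ suc a) s) ∎

  ps1-val : ps1 ≐ (t^ 0 · (δ ⊗ δ))
  ps1-val zero    zero    zero    zero    zero    = refl
  ps1-val zero    zero    zero    zero    (suc q) = refl
  ps1-val zero    zero    zero    (suc p) q       = sym (*-zeroˡ (δ q))
  ps1-val zero    zero    (suc l) p       q       = refl
  ps1-val zero    (suc j) l       p       q       = refl
  ps1-val (suc i) zero    zero    p       q       = refl
  ps1-val (suc i) zero    (suc l) p       q       = refl
  ps1-val (suc i) (suc j) l       p       q       = refl

  var-t-val : var-t ≐ (t^ 1 · (δ ⊗ δ))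
  var-t-val zero          zero    zero    p       q       = refl
  var-t-val zero          zero    (suc l) p       q       = refl
  var-t-val zero          (suc j) l       p       q       = refl
  var-t-val (suc zero)    zero    zero    zero    zero    = refl
  var-t-val (suc zero)    zero    zero    zero    (suc q) = refl
  var-t-val (suc zero)    zero    zero    (suc p) q       = sym (*-zeroˡ (δ q))
  var-t-val (suc zero)    zero    (suc l) p       q       = refl
  var-t-val (suc zero)    (suc j) l       p       q       = refl
  var-t-val (suc (suc i)) zero    zero    p       q       = refl
  var-t-val (suc (suc i)) zero    (suc l) p       q       = refl
  var-t-val (suc (suc i)) (suc j) l       p       q       = refl

  X-val : (exp-x ⊖ ps1) ≐ (t^ 0 · (expm1 ⊗ δ))
  X-val zero    zero    zero    zero    zero    = refl
  X-val zero    zero    zero    (suc p) zero    = trans (+-identityʳ (inv! (suc p))) (sym (*-identityʳ (inv! (suc p))))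
  X-val zero    zero    zero    zero    (suc q) = refl
  X-val zero    zero    zero    (suc p) (suc q) = sym (*-zeroʳ (inv! (suc p)))
  X-val zero    zero    (suc l) p       q       = refl
  X-val zero    (suc j) l       p       q       = refl
  X-val (suc i) zero    zero    p       q       = refl
  X-val (suc i) zero    (suc l) p       q       = refl
  X-val (suc i) (suc j) l       p       q       = refl

  Y-val : (exp-y ⊖ ps1) ≐ (t^ 0 · (δ ⊗ expm1))
  Y-val zero    zero    zero    zero    zero    = refl
  Y-val zero    zero    zero    zero    (suc q) = trans (+-identityʳ (inv! (suc q))) (sym (*-identityˡ (inv! (suc q))))
  Y-val zero    zero    zero    (suc p) q       = sym (*-zeroˡ (expm1 q))
  Y-val zero    zero    (suc l) p       q       = refl
  Y-val zero    (suc j) l       p       q       = refl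
  Y-val (suc i) zero    zero    p       q       = refl
  Y-val (suc i) zero    (suc l) p       q       = refl
  Y-val (suc i) (suc j) l       p       q       = refl

  T : PS
  T = var-t ⊛ ((exp-x ⊖ ps1) ⊛ (exp-y ⊖ ps1))

  T-val : T ≐ (t^ 1 · (expm1 ⊗ expm1))
  T-val = ≐-trans (⊛-cong var-t-val (≐-trans (⊛-cong X-val Y-val) (≐-trans (t^·-⊛ 0 0 (expm1 ⊗ δ) (δ ⊗ expm1)) (t^·-cong 0 XY-part))))
                  (≐-trans (t^·-⊛ 1 0 (δ ⊗ δ) (expm1 ⊗ expm1)) (t^·-cong 1 T-part))
    where
      XY-part : ∀ p q → ((expm1 ⊗ δ) ⋆ (δ ⊗ expm1)) p q ≡ (expm1 ⊗ expm1) p q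
      XY-part p q = trans (⊗-⋆-⊗ expm1 δ δ expm1 p q) (cong₂ _*_ (∗-δ expm1 p) (δ-∗ expm1 q))
      T-part : ∀ p q → ((δ ⊗ δ) ⋆ (expm1 ⊗ expm1)) p q ≡ (expm1 ⊗ expm1) p q
      T-part p q = trans (⊗-⋆-⊗ δ δ expm1 expm1 p q) (cong₂ _*_ (δ-∗ expm1 p) (δ-∗ expm1 q))

  F : PS
  F = ps1 ⊖ (ps1 ⊖ T)

  F-val : F ≐ (t^ 1 · (expm1 ⊗ expm1))
  F-val i j l p q = trans (x-[x-y]≡y (ps1 i j l p q) (T i j l p q)) (T-val i j l p q)
    where
      x-[x-y]≡y : ∀ x y → x - (x - y) ≡ y
      x-[x-y]≡y = solve 2 (λ x y → x :- (x :- y) := y) refl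

  F^-val : ∀ s → (F ^ps s) ≐ (t^ s · (egf-surj s ⊗ egf-surj s))
  F^-val zero    = ≐-trans ps1-val (t^·-cong 0 (λ p q → sym (cong₂ _*_ (egf-surj-zero p) (egf-surj-zero q))))
  F^-val (suc s) = ≐-trans (⊛-cong F-val (F^-val s)) (≐-trans (t^·-⊛ 1 s (expm1 ⊗ expm1) (egf-surj s ⊗ egf-surj s)) (t^·-cong (suc s) λ p q →
    trans (⊗-⋆-⊗ expm1 expm1 (egf-surj s) (egf-surj s) p q) (cong₂ _*_ (expm1-∗-egf-surj s p) (expm1-∗-egf-surj s q))))

  -- Only the power F^i contributes to t^i.
  geom-F-val : ∀ i j l p q → geom F i j l p q ≡ (t^ i · (egf-surj i ⊗ egf-surj i)) i j l p q
  geom-F-val i j l p q = trans (Σ≤-cong N (λ s _ → F^-val s i j l p q))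
    (Σ≤-single N i (λ s → (t^ s · (egf-surj s ⊗ egf-surj s)) i j l p q) i≤N
               (λ s _ s≢i → t^·-off s (egf-surj s ⊗ egf-surj s) i j l p q (λ i≡s → s≢i (sym i≡s))))
    where
      N = i ℕ.+ j ℕ.+ l ℕ.+ p ℕ.+ q
      i≤N : i ≤ N
      i≤N = ℕP.≤-trans (ℕP.≤-trans (ℕP.≤-trans (ℕP.m≤m+n i j) (ℕP.m≤m+n (i ℕ.+ j) l)) (ℕP.m≤m+n (i ℕ.+ j ℕ.+ l) p))
                       (ℕP.m≤m+n (i ℕ.+ j ℕ.+ l ℕ.+ p) q)

  ax-coeff : ℕ → ℕ → ℚ
  ax-coeff j d = if j ≡ᵇ d then inv! d else 0ℚ

  ax-coeff-off : ∀ {j d} → d ≢ j → ax-coeff j d ≡ 0ℚ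
  ax-coeff-off d≢j rewrite ≢⇒≡ᵇ-false (λ j≡d → d≢j (sym j≡d)) = refl

  ax-coeff-∗-egf-surj : ∀ i j n → (ax-coeff j ∗ egf-surj i) n ≡ ι (binom n j ℕ.* surj (n ∸ j) i) * inv! n
  ax-coeff-∗-egf-surj i j n with j ≤? n
  ... | no j≰n = begin
    Σ≤ n (λ d → ax-coeff j d * egf-surj i (n ∸ d))
      ≡⟨ Σ≤-zero n (λ d d≤n → trans (cong (_* egf-surj i (n ∸ d)) (ax-coeff-off (λ d≡j → j≰n (subst (_≤ n) d≡j d≤n))))
                                    (*-zeroˡ (egf-surj i (n ∸ d)))) ⟩
    0ℚ
      ≡⟨ sym (*-zeroˡ (inv! n)) ⟩
    ι 0 * inv! n
      ≡⟨ cong (λ b → ι (b ℕ.* surj (n ∸ j) i) * inv! n) (sym (binom-above n j (ℕP.≰⇒> j≰n))) ⟩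
    ι (binom n j ℕ.* surj (n ∸ j) i) * inv! n ∎
  ... | yes j≤n = begin
    Σ≤ n (λ d → ax-coeff j d * egf-surj i (n ∸ d))
      ≡⟨ Σ≤-single n j _ j≤n (λ d _ d≢j → trans (cong (_* egf-surj i (n ∸ d)) (ax-coeff-off d≢j)) (*-zeroˡ (egf-surj i (n ∸ d)))) ⟩
    ax-coeff j j * (inv! (n ∸ j) * ι (surj (n ∸ j) i))
      ≡⟨ cong (λ b → (if b then inv! j else 0ℚ) * (inv! (n ∸ j) * ι (surj (n ∸ j) i))) (≡ᵇ-refl j) ⟩
    inv! j * (inv! (n ∸ j) * ι (surj (n ∸ j) i))
      ≡⟨ sym (*-assoc (inv! j) (inv! (n ∸ j)) (ι (surj (n ∸ j) i))) ⟩
    inv! j * inv! (n ∸ j) * ι (surj (n ∸ j) i)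
      ≡⟨ cong (_* ι (surj (n ∸ j) i)) (inv!*inv!-∸ j≤n) ⟩
    ι (binom n j) * inv! n * ι (surj (n ∸ j) i)
      ≡⟨ solve 3 (λ b m s → b :* m :* s := b :* s :* m) refl (ι (binom n j)) (inv! n) (ι (surj (n ∸ j) i)) ⟩
    ι (binom n j) * ι (surj (n ∸ j) i) * inv! n
      ≡⟨ cong (_* inv! n) (sym (ι-* (binom n j) (surj (n ∸ j) i))) ⟩
    ι (binom n j ℕ.* surj (n ∸ j) i) * inv! n ∎

  exp-ax-by : PS
  exp-ax-by zero    j l p q = (ax-coeff j ⊗ ax-coeff l) p q
  exp-ax-by (suc i) j l p q = 0ℚ

  exp-ax-by-val : (exp-ax ⊛ exp-by) ≐ exp-ax-by
  exp-ax-by-val (suc i) j l p q = ⊛-vanishes exp-ax exp-by (suc i) j l p q vanish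
    where
      vanish : ∀ a b c d e → a ≤ suc i → b ≤ j → c ≤ l → d ≤ p → e ≤ q →
               exp-ax a b c d e * exp-by (suc i ∸ a) (j ∸ b) (l ∸ c) (p ∸ d) (q ∸ e) ≡ 0ℚ
      vanish zero    b c d e _ _ _ _ _ = *-zeroʳ (exp-ax 0 b c d e)
      vanish (suc a) b c d e _ _ _ _ _ = *-zeroˡ (exp-by (suc i ∸ suc a) (j ∸ b) (l ∸ c) (p ∸ d) (q ∸ e))
  exp-ax-by-val zero j l p q = begin
    (exp-ax ⊛ exp-by) 0 j l p q
      ≡⟨ ⊛-collapse exp-ax exp-by 0 j l p q 0 j 0 z≤n ℕP.≤-refl z≤n off-a off-b off-c ⟩
    Σ≤ p (λ d → Σ≤ q (λ e → exp-ax 0 j 0 d e * exp-by 0 (j ∸ j) l (p ∸ d) (q ∸ e)))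
      ≡⟨ Σ≤-cong p (λ d _ → Σ≤-cong q (λ e _ → cong₂ _*_ (a-part d e) (b-part (p ∸ d) (q ∸ e)))) ⟩
    ((ax-coeff j ⊗ δ) ⋆ (δ ⊗ ax-coeff l)) p q
      ≡⟨ ⊗-⋆-⊗ (ax-coeff j) δ δ (ax-coeff l) p q ⟩
    (ax-coeff j ∗ δ) p * (δ ∗ ax-coeff l) q
      ≡⟨ cong₂ _*_ (∗-δ (ax-coeff j) p) (δ-∗ (ax-coeff l) q) ⟩
    (ax-coeff j ⊗ ax-coeff l) p q ∎
    where
      off-a : ∀ a → a ≤ 0 → a ≢ 0 → ∀ b c d e → exp-ax a b c d e * exp-by (0 ∸ a) (j ∸ b) (l ∸ c) (p ∸ d) (q ∸ e) ≡ 0ℚ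
      off-a zero    _ 0≢0 = ⊥-elim (0≢0 refl)
      off-a (suc a) _ _ b c d e = *-zeroˡ (exp-by 0 (j ∸ b) (l ∸ c) (p ∸ d) (q ∸ e))
      off-b : ∀ b → b ≤ j → b ≢ j → ∀ c d e → exp-ax 0 b c d e * exp-by 0 (j ∸ b) (l ∸ c) (p ∸ d) (q ∸ e) ≡ 0ℚ
      off-b b b≤j b≢j c d e with j ∸ b in eq
      ... | zero  = ⊥-elim (b≢j (ℕP.≤-antisym b≤j (ℕP.m∸n≡0⇒m≤n eq)))
      ... | suc _ = *-zeroʳ (exp-ax 0 b c d e)
      off-c : ∀ c → c ≤ l → c ≢ 0 → ∀ d e → exp-ax 0 j c d e * exp-by 0 (j ∸ j) (l ∸ c) (p ∸ d) (q ∸ e) ≡ 0ℚ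
      off-c zero    _ 0≢0 = ⊥-elim (0≢0 refl)
      off-c (suc c) _ _ d e = *-zeroˡ (exp-by 0 (j ∸ j) (l ∸ suc c) (p ∸ d) (q ∸ e))
      a-part : ∀ d e → exp-ax 0 j 0 d e ≡ (ax-coeff j ⊗ δ) d e
      a-part d zero    = sym (*-identityʳ (ax-coeff j d))
      a-part d (suc e) = sym (*-zeroʳ (ax-coeff j d))
      b-part : ∀ d e → exp-by 0 (j ∸ j) l d e ≡ (δ ⊗ ax-coeff l) d e
      b-part d e rewrite ℕP.n∸n≡0 j with d
      ... | zero  = sym (*-identityˡ (ax-coeff l e))
      ... | suc _ = sym (*-zeroˡ (ax-coeff l e))

  RHS-val : ∀ i j l n k → RHS i j l n k ≡ ι (countFormula i j l n k) * inv! n * inv! k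
  RHS-val i j l n k = begin
    RHS i j l n k
      ≡⟨ ⊛-cong exp-ax-by-val (λ i j l p q → geom-F-val i j l p q) i j l n k ⟩
    (exp-ax-by ⊛ G) i j l n k
      ≡⟨ ⊛-collapse exp-ax-by G i j l n k 0 j l z≤n ℕP.≤-refl ℕP.≤-refl off-a off-b off-c ⟩
    Σ≤ n (λ d → Σ≤ k (λ g → exp-ax-by 0 j l d g * G i (j ∸ j) (l ∸ l) (n ∸ d) (k ∸ g)))
      ≡⟨ Σ≤-cong n (λ d _ → Σ≤-cong k (λ g _ → cong (exp-ax-by 0 j l d g *_) (G-part (n ∸ d) (k ∸ g)))) ⟩
    ((ax-coeff j ⊗ ax-coeff l) ⋆ (egf-surj i ⊗ egf-surj i)) n k
      ≡⟨ ⊗-⋆-⊗ (ax-coeff j) (ax-coeff l) (egf-surj i) (egf-surj i) n k ⟩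
    (ax-coeff j ∗ egf-surj i) n * (ax-coeff l ∗ egf-surj i) k
      ≡⟨ cong₂ _*_ (ax-coeff-∗-egf-surj i j n) (ax-coeff-∗-egf-surj i l k) ⟩
    ι (binom n j ℕ.* rows) * inv! n * (ι (binom k l ℕ.* cols) * inv! k)
      ≡⟨ cong₂ (λ x y → x * inv! n * (y * inv! k)) (ι-* (binom n j) rows) (ι-* (binom k l) cols) ⟩
    ι (binom n j) * ι rows * inv! n * (ι (binom k l) * ι cols * inv! k)
      ≡⟨ solve 6 (λ a r m b c w → a :* r :* m :* (b :* c :* w) := a :* b :* (r :* c) :* m :* w) refl
               (ι (binom n j)) (ι rows) (inv! n) (ι (binom k l)) (ι cols) (inv! k) ⟩
    ι (binom n j) * ι (binom k l) * (ι rows * ι cols) * inv! n * inv! k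
      ≡⟨ cong (λ x → x * inv! n * inv! k)
              (sym (trans (ι-* (binom n j ℕ.* binom k l) (rows ℕ.* cols)) (cong₂ _*_ (ι-* (binom n j) (binom k l)) (ι-* rows cols)))) ⟩
    ι (countFormula i j l n k) * inv! n * inv! k ∎
    where
      rows = surj (n ∸ j) i
      cols = surj (k ∸ l) i
      G : PS
      G i j l p q = (t^ i · (egf-surj i ⊗ egf-surj i)) i j l p q
      off-a : ∀ a → a ≤ i → a ≢ 0 → ∀ b c d e → exp-ax-by a b c d e * G (i ∸ a) (j ∸ b) (l ∸ c) (n ∸ d) (k ∸ e) ≡ 0ℚ
      off-a zero    _ 0≢0 = ⊥-elim (0≢0 refl)
      off-a (suc a) _ _ b c d e = *-zeroˡ (G (i ∸ suc a) (j ∸ b) (l ∸ c) (n ∸ d) (k ∸ e))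
      off-b : ∀ b → b ≤ j → b ≢ j → ∀ c d e → exp-ax-by 0 b c d e * G i (j ∸ b) (l ∸ c) (n ∸ d) (k ∸ e) ≡ 0ℚ
      off-b b b≤j b≢j c d e with j ∸ b in eq
      ... | zero  = ⊥-elim (b≢j (ℕP.≤-antisym b≤j (ℕP.m∸n≡0⇒m≤n eq)))
      ... | suc _ = *-zeroʳ (exp-ax-by 0 b c d e)
      off-c : ∀ c → c ≤ l → c ≢ l → ∀ d e → exp-ax-by 0 j c d e * G i (j ∸ j) (l ∸ c) (n ∸ d) (k ∸ e) ≡ 0ℚ
      off-c c c≤l c≢l d e rewrite ℕP.n∸n≡0 j with l ∸ c in eq
      ... | zero  = ⊥-elim (c≢l (ℕP.≤-antisym c≤l (ℕP.m∸n≡0⇒m≤n eq)))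
      ... | suc _ = *-zeroʳ (exp-ax-by 0 j c d e)
      G-part : ∀ p q → G i (j ∸ j) (l ∸ l) p q ≡ (egf-surj i ⊗ egf-surj i) p q
      G-part p q rewrite ℕP.n∸n≡0 j | ℕP.n∸n≡0 l = t^·-on i (egf-surj i ⊗ egf-surj i) p q


open import Data.Rational using (_*_)
open RationalEmbedding using (ι)
open RefinedCount using (countG≡countFormula)
open RHSCoefficients using (RHS-val)

corollary3 : ∀ (i j l n k : ℕ) → LHS i j l n k ≡ RHS i j l n k
corollary3 i j l n k =
  trans (cong (λ c → ι c * inv! n * inv! k) (countG≡countFormula i j l n k)) (sym (RHS-val i j l n k))
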